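{- Let $\nu\ge 1$ be an integer, let $0\le s,b\le \nu$ and let $L\ge 0$ be integers. Then \[ C_{0,L}^\nu(s,b,q)=\begin{cases} B^\nu_{\nu+1-s,\,\nu+1-b}(L,q), & \text{if } L\equiv s+b \pmod 2,\\[2pt] B^\nu_{\nu+2+s,\,\nu+1-b}(L,q), & \text{otherwise.}\end{cases} \]
   Context: For integers $n,m$, set $(q)_n=\prod_{i=1}^{n}(1-q^i)$ and define the $q$-binomial coefficient $\left[{n+m \atop n}\right]_q=\frac{(q)_{n+m}}{(q)_n (q)_m}$ if $n,m\in\mathbb Z_{\ge 0}$ and $0$ otherwise; equivalently $\left[{L\atop k}\right]_q$ is $\frac{(q)_L}{(q)_k(q)_{L-k}}$ for $0\le k\le L$ and $0$ otherwise. A Bressoud path is a lattice path with vertices in $\mathbb Z\times\mathbb Z_{\ge 0}$ built from three kinds of steps: NE steps $(i,j)\to(i+1,j+1)$; SE steps $(i,j)\to(i+1,j-1)$, allowed only if $j>0$; horizontal steps $(i,0)\to(i+1,0)$, allowed only along the $x$-axis. A peak is a vertex preceded by an NE step and followed by an SE step; its height is its $y$-coordinate and its weight its $x$-coordinate. The weight $w(p)$ of a path $p$ is the sum of the weights of its peaks. For integers $M\le L$ and $0\le s,b\le\nu$, $C^\nu_{M,L}(s,b,q)=\sum_p q^{w(p)}$, the sum over all Bressoud paths from $(M,s)$ to $(L,b)$ having no peak of height greater than $\nu$. For integers $s,b$ and $L\ge 0$ with $L\equiv s+b\pmod 2$, \[ B^\nu_{s,b}(L,q)=\sum_{j=-\infty}^{\infty}\left\{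 q^{j((2j+1)(2\nu+3)-2s)}\left[{L\atop \frac{L+b-s}{2}+j(2\nu+3)}\right]_q - q^{(2j+1)((2\nu+3)j+s)}\left[{L\atop \frac{L+b+s}{2}+j(2\nu+3)}\right]_q\right\}. \] -}

module Defs where

open import Data.Nat as ℕ using (ℕ; zero; suc)
open import Data.Integer as ℤ using (ℤ; +_; -[1+_]; _+_; _*_; _-_; -_; ∣_∣)
open import Data.Integer.Base using (_/ℕ_)
open import Data.Product using (_×_; _,_; proj₁; proj₂)
open import Data.List as List using (List; []; _∷_; _++_; map; concatMap; foldr; filter)
open import Data.Bool using (Bool; true; false; if_then_else_; _∧_)
open import Data.Maybe using (Maybe; just; nothing)
open import Relation.Binary.PropositionalEquality using (_≡_)
open import Relation.Nullary.Decidable using (⌊_⌋)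

-- Laurent polynomials in q with integer coefficients, represented as
-- finite formal sums  Σ c · q^e  given by a list of (exponent e , coefficient c).

Poly : Set
Poly = List (ℤ × ℤ)

coeff : Poly → ℤ → ℤ
coeff [] n = + 0
coeff ((e , c) ∷ p) n = (if ⌊ e ℤ.≟ n ⌋ then c else + 0) + coeff p n

infix 4 _≈_
_≈_ : Poly → Poly → Set
p ≈ r = ∀ (n : ℤ) → coeff p n ≡ coeff r n

zeroP : Poly
zeroP = []

oneP : Poly
oneP = (+ 0 , + 1) ∷ []

monomial : ℤ → Poly
monomial e = (e , + 1) ∷ []

_⊕_ : Poly → Poly → Poly
p ⊕ r = p ++ r

⊖_ : Poly → Poly
⊖ p = map (λ ec → proj₁ ec , - proj₂ ec) p

_⊗_ : Poly → Poly → Poly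
p ⊗ r = concatMap (λ ec → map (λ fd → proj₁ ec + proj₁ fd , proj₂ ec * proj₂ fd) r) p

shift : ℤ → Poly → Poly
shift e p = map (λ ec → e + proj₁ ec , proj₂ ec) p

-- Gaussian (q-binomial) coefficient [L choose k]_q, for L : ℕ, k : ℤ,
-- equal to 0 unless 0 ≤ k ≤ L.  Defined as the polynomial by the
-- q-Pascal recurrence  [L+1,k] = [L,k-1] + q^k [L,k],  [0,k] = δ_{k,0}
-- (this polynomial equals (q)_L / ((q)_k (q)_{L-k}) for 0 ≤ k ≤ L).

qbin : ℕ → ℤ → Poly
qbin zero (+ zero) = oneP
qbin zero _        = zeroP
qbin (suc L) k     = qbin L (k - + 1) ⊕ shift k (qbin L k)

sumRange : ℕ → (ℤ → Poly) → Poly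
sumRange T f = foldr (λ i acc → f (+ i - + T) ⊕ acc) zeroP (List.upTo (suc (2 ℕ.* T)))

-- The sum over j ∈ ℤ is finite: for |j| > L + |s| + |b|
-- both q-binomials vanish (their lower index lies outside [0,L]), so the
-- sum is taken over |j| ≤ L + |s| + |b| + 1.  The halvings (L+b∓s)/2 are
-- exact under the standing assumption L ≡ s+b (mod 2).

half : ℤ → ℤ
half x = x /ℕ 2

Bfun : ℕ → ℤ → ℤ → ℕ → Poly
Bfun ν s b L =
  sumRange (L ℕ.+ ∣ s ∣ ℕ.+ ∣ b ∣ ℕ.+ 1) λ j →
    shift (j * ((+ 2 * j + + 1) * K - + 2 * s))
          (qbin L (half (+ L + b - s) + j * K))
    ⊕ (⊖ shift ((+ 2 * j + + 1) * (K * j + s))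
               (qbin L (half (+ L + b + s) + j * K)))
  where
    K : ℤ
    K = + (2 ℕ.* ν ℕ.+ 3)

-- Bressoud paths.  A path starting at x = M is encoded by its list of
-- steps: ne = (i,j)→(i+1,j+1), se = (i,j)→(i+1,j-1), hz = (i,0)→(i+1,0).

data Step : Set where
  ne se hz : Step

allSeqs : ℕ → List (List Step)
allSeqs zero    = [] ∷ []
allSeqs (suc n) = concatMap (λ p → (ne ∷ p) ∷ (se ∷ p) ∷ (hz ∷ p) ∷ []) (allSeqs n)

endpoint : ℕ → List Step → Maybe ℕ
endpoint h       []       = just h
endpoint h       (ne ∷ r) = endpoint (suc h) r
endpoint zero    (se ∷ r) = nothing
endpoint (suc h) (se ∷ r) = endpoint h r
endpoint zero    (hz ∷ r) = endpoint zero r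
endpoint (suc h) (hz ∷ r) = nothing

peaks : ℤ → ℕ → List Step → List (ℤ × ℕ)
peaks x h (ne ∷ se ∷ r) = (x + + 1 , suc h) ∷ peaks (x + + 1) (suc h) (se ∷ r)
peaks x h (ne ∷ r)      = peaks (x + + 1) (suc h) r
peaks x h (se ∷ r)      = peaks (x + + 1) (h ℕ.∸ 1) r
peaks x h (hz ∷ r)      = peaks (x + + 1) h r
peaks x h []            = []

eqMaybe : Maybe ℕ → ℕ → Bool
eqMaybe (just m) b = m ℕ.≡ᵇ b
eqMaybe nothing  b = false

allLow : ℕ → List (ℤ × ℕ) → Bool
allLow ν ps = foldr _∧_ true (map (λ xh → proj₂ xh ℕ.≤ᵇ ν) ps)

weight : List (ℤ × ℕ) → ℤ
weight ps = foldr (λ xh acc → proj₁ xh + acc) (+ 0) ps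

-- C^ν_{M,M+n}(s,b,q): sum of q^{w(p)} over Bressoud paths p from (M,s) to
-- (M+n,b) with no peak of height > ν.
Cfun : ℕ → ℤ → ℕ → ℕ → ℕ → Poly
Cfun ν M n s b =
  foldr (λ p acc → monomial (weight (peaks M s p)) ⊕ acc) zeroP
    (List.filterᵇ (λ p → eqMaybe (endpoint s p) b ∧ allLow ν (peaks M s p)) (allSeqs n))

-- Both sides satisfy the same recurrence in L and agree at L = 0. Sorting paths by their last
-- step (an SE step after an NE step closes a peak of height b + 1 at x = L) gives, for 0 < b < ν,
--   C(L+1, b) = C(L, b-1) + C(L, b+1) - (1 - q^L) C(L-1, b);
-- for b = ν only C(L, b-1) remains, since no peak may exceed ν, and for b = 0 a horizontal step
-- takes the place of C(L, b-1), contributing C(L, 0). With β = ν + 1 - b, the q-binomial recurrence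
-- [L+1, k] = [L, k] + [L, k-1] - (1 - q^L) [L-1, k-1] gives the same relation termwise for B.
-- At b = ν the term with β = 0 and the correction cancel: together their summands have the form
-- Y(-j) - Y(j). At b = 0 the term with β = ν + 2 becomes, under j ↦ -j, j ↦ -1-j and
-- [L, k] = [L, L-k], B with σ replaced by 2ν + 3 - σ, which is B for the other parity class at
-- b = 0. At L = 0 only the j = 0 summand of B survives.

module Submission where

open import Defs

module _ where

  open import Data.Bool using (Bool; true; false; if_then_else_; _∧_; not; T)
  import Data.Bool.Properties as BoolP
  open import Data.Empty using (⊥-elim)
  open import Data.Integer as ℤ using (ℤ; +_; -[1+_]; _+_; _*_; _-_; -_; ∣_∣)
  import Data.Integer.DivMod as ℤD
  import Data.Integer.Properties as ℤP
  open import Data.Integer.Tactic.RingSolver using (solve-∀)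
  open import Data.List as List using (List; []; _∷_; _++_)
  import Data.List.Properties as ListP
  open import Data.Maybe using (Maybe; just; nothing)
  open import Data.Nat as ℕ using (ℕ; zero; suc; z≤n; s≤s)
  open import Data.Nat.DivMod using (_%_; _/_; m≡m%n+[m/n]*n; m%n<n)
  import Data.Nat.Properties as ℕP
  import Data.Nat.Tactic.RingSolver as ℕRing
  open import Data.Product using (Σ; _×_; _,_; proj₁; proj₂)
  open import Data.Sum using (_⊎_; inj₁; inj₂)
  open import Function using (_∘_; _⇔_; mk⇔)
  open import Relation.Binary.PropositionalEquality
  open import Relation.Nullary using (¬_; yes; no)
  open import Relation.Nullary.Decidable using (⌊_⌋; isYes≗does; does-⇔)

  open ≡-Reasoning

  sumList : {A : Set} → List A → (A → ℤ) → ℤ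
  sumList xs f = List.foldr (λ x acc → f x + acc) (+ 0) xs

  sumList-cong : {A : Set} (xs : List A) {f g : A → ℤ} → f ≗ g → sumList xs f ≡ sumList xs g
  sumList-cong []       eq = refl
  sumList-cong (x ∷ xs) eq = cong₂ _+_ (eq x) (sumList-cong xs eq)

  sumList-+ : {A : Set} (xs : List A) (f g : A → ℤ) →
              sumList xs (λ x → f x + g x) ≡ sumList xs f + sumList xs g
  sumList-+ []       f g = refl
  sumList-+ (x ∷ xs) f g = begin
    f x + g x + sumList xs (λ x → f x + g x)   ≡⟨ cong (λ z → (f x + g x) + z) (sumList-+ xs f g) ⟩
    f x + g x + (sumList xs f + sumList xs g)  ≡⟨ swap (f x) (g x) _ _ ⟩
    f x + sumList xs f + (g x + sumList xs g)  ∎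
    where
    swap : ∀ a b c d → a + b + (c + d) ≡ a + c + (b + d)
    swap = solve-∀

  sumList-++ : {A : Set} (xs ys : List A) (f : A → ℤ) →
               sumList (xs ++ ys) f ≡ sumList xs f + sumList ys f
  sumList-++ []       ys f = sym (ℤP.+-identityˡ _)
  sumList-++ (x ∷ xs) ys f =
    trans (cong (λ z → f x + z) (sumList-++ xs ys f)) (sym (ℤP.+-assoc (f x) _ _))

  sumList-zero : {A : Set} (xs : List A) → sumList xs (λ _ → + 0) ≡ + 0
  sumList-zero []       = refl
  sumList-zero (x ∷ xs) = trans (ℤP.+-identityˡ _) (sumList-zero xs)

  sumList-concatMap : {A B : Set} (g : A → List B) (xs : List A) (f : B → ℤ) →
                      sumList (List.concatMap g xs) f ≡ sumList xs (λ x → sumList (g x) f)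
  sumList-concatMap g []       f = refl
  sumList-concatMap g (x ∷ xs) f = trans (sumList-++ (g x) (List.concatMap g xs) f)
                                         (cong (λ z → sumList (g x) f + z) (sumList-concatMap g xs f))

  sumList-comm : {A B : Set} (xs : List A) (ys : List B) (f : A → B → ℤ) →
                 sumList xs (λ x → sumList ys (f x)) ≡ sumList ys (λ y → sumList xs (λ x → f x y))
  sumList-comm []       ys f = sym (sumList-zero ys)
  sumList-comm (x ∷ xs) ys f = trans (cong (λ z → sumList ys (f x) + z) (sumList-comm xs ys f))
                                     (sym (sumList-+ ys (f x) (λ y → sumList xs (λ x → f x y))))

  ⌊≟⌋-cong : ∀ {a b a′ b′ : ℤ} → (a ≡ b ⇔ a′ ≡ b′) → ⌊ a ℤ.≟ b ⌋ ≡ ⌊ a′ ℤ.≟ b′ ⌋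
  ⌊≟⌋-cong {a} {b} {a′} {b′} a⇔a′ = trans (isYes≗does (a ℤ.≟ b))
    (trans (does-⇔ a⇔a′ (a ℤ.≟ b) (a′ ℤ.≟ b′)) (sym (isYes≗does (a′ ℤ.≟ b′))))

  e+x≡n⇔x≡n-e : ∀ e x n → (e + x ≡ n) ⇔ (x ≡ n - e)
  e+x≡n⇔x≡n-e e x n = mk⇔ (λ eq → trans (cancel e x) (cong (_- e) eq))
                    (λ eq → trans (cong (λ z → e + z) eq) (uncancel e n))
    where
    cancel : ∀ e x → x ≡ e + x - e
    cancel = solve-∀
    uncancel : ∀ e n → e + (n - e) ≡ n
    uncancel = solve-∀

  coeff-⊕ : ∀ p r n → coeff (p ⊕ r) n ≡ coeff p n + coeff r n
  coeff-⊕ []            r n = sym (ℤP.+-identityˡ _)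
  coeff-⊕ ((e , c) ∷ p) r n =
    trans (cong (λ z → c′ + z) (coeff-⊕ p r n)) (sym (ℤP.+-assoc c′ (coeff p n) (coeff r n)))
    where
    c′ : ℤ
    c′ = if ⌊ e ℤ.≟ n ⌋ then c else + 0

  coeff-⊖ : ∀ p n → coeff (⊖ p) n ≡ - coeff p n
  coeff-⊖ []            n = refl
  coeff-⊖ ((e , c) ∷ p) n =
    trans (cong₂ _+_ (if-neg ⌊ e ℤ.≟ n ⌋) (coeff-⊖ p n))
          (sym (ℤP.neg-distrib-+ (if ⌊ e ℤ.≟ n ⌋ then c else + 0) (coeff p n)))
    where
    if-neg : ∀ t → (if t then - c else + 0) ≡ - (if t then c else + 0)
    if-neg true  = refl
    if-neg false = refl

  coeff-shift : ∀ e p n → coeff (shift e p) n ≡ coeff p (n - e)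
  coeff-shift e []             n = refl
  coeff-shift e ((e′ , c) ∷ p) n =
    cong₂ _+_ (cong (λ t → if t then c else + 0) (⌊≟⌋-cong (e+x≡n⇔x≡n-e e e′ n))) (coeff-shift e p n)

  coeff-foldr-⊕ : {A : Set} (g : A → Poly) (xs : List A) (n : ℤ) →
    coeff (List.foldr (λ x acc → g x ⊕ acc) zeroP xs) n ≡ sumList xs (λ x → coeff (g x) n)
  coeff-foldr-⊕ g []       n = refl
  coeff-foldr-⊕ g (x ∷ xs) n =
    trans (coeff-⊕ (g x) _ n) (cong (λ z → coeff (g x) n + z) (coeff-foldr-⊕ g xs n))

  -- Sums over ℤ

  symSum : ℕ → (ℤ → ℤ) → ℤ
  symSum zero    f = f (+ 0)
  symSum (suc T) f = symSum T f + (f (+ suc T) + f -[1+ T ])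

  symSum-cong : ∀ T {f g : ℤ → ℤ} → f ≗ g → symSum T f ≡ symSum T g
  symSum-cong zero    eq = eq (+ 0)
  symSum-cong (suc T) eq = cong₂ _+_ (symSum-cong T eq) (cong₂ _+_ (eq _) (eq _))

  symSum-+ : ∀ T (f g : ℤ → ℤ) → symSum T (λ j → f j + g j) ≡ symSum T f + symSum T g
  symSum-+ zero    f g = refl
  symSum-+ (suc T) f g = trans (cong (_+ ((f (+ suc T) + g (+ suc T)) + (f -[1+ T ] + g -[1+ T ])))
                                      (symSum-+ T f g))
                                (swap (symSum T f) (symSum T g) (f (+ suc T)) (g (+ suc T))
                                      (f -[1+ T ]) (g -[1+ T ]))
    where
    swap : ∀ a b c d e h → a + b + ((c + d) + (e + h)) ≡ a + (c + e) + (b + (d + h))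
    swap = solve-∀

  symSum-neg : ∀ T (f : ℤ → ℤ) → symSum T (λ j → - f j) ≡ - symSum T f
  symSum-neg zero    f = refl
  symSum-neg (suc T) f = trans (cong (_+ (- f (+ suc T) + - f -[1+ T ])) (symSum-neg T f))
                                (distrib (symSum T f) (f (+ suc T)) (f -[1+ T ]))
    where
    distrib : ∀ a c e → - a + (- c + - e) ≡ - (a + (c + e))
    distrib = solve-∀

  symSum-- : ∀ T (f g : ℤ → ℤ) → symSum T (λ j → f j - g j) ≡ symSum T f - symSum T g
  symSum-- T f g = trans (symSum-+ T f (λ j → - g j)) (cong (λ z → symSum T f + z) (symSum-neg T g))

  symSum-∘-neg : ∀ T (f : ℤ → ℤ) → symSum T (f ∘ -_) ≡ symSum T f
  symSum-∘-neg zero    f = refl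
  symSum-∘-neg (suc T) f = cong₂ _+_ (symSum-∘-neg T f) (ℤP.+-comm (f -[1+ T ]) (f (+ suc T)))

  -- j ↦ -1-j maps [-T, T] onto [-T-1, T-1]
  symSum-∘-mirror : ∀ T (f : ℤ → ℤ) →
    symSum T (λ j → f (- j - + 1)) + f (+ T) ≡ symSum T f + f -[1+ T ]
  symSum-∘-mirror zero    f = ℤP.+-comm (f -[1+ 0 ]) (f (+ 0))
  symSum-∘-mirror (suc T) f = begin
    symSum T f′ + (f′ (+ suc T) + f′ -[1+ T ]) + f (+ suc T)
      ≡⟨ cong₂ (λ x y → symSum T f′ + (f x + f y) + f (+ suc T)) (mirror-pos T) (mirror-neg T) ⟩
    symSum T f′ + (f -[1+ suc T ] + f (+ T)) + f (+ suc T)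
      ≡⟨ swap₁ (symSum T f′) (f -[1+ suc T ]) (f (+ T)) (f (+ suc T)) ⟩
    symSum T f′ + f (+ T) + f -[1+ suc T ] + f (+ suc T)
      ≡⟨ cong (λ x → x + f -[1+ suc T ] + f (+ suc T)) (symSum-∘-mirror T f) ⟩
    symSum T f + f -[1+ T ] + f -[1+ suc T ] + f (+ suc T)
      ≡⟨ swap₂ (symSum T f) (f -[1+ T ]) (f -[1+ suc T ]) (f (+ suc T)) ⟩
    symSum T f + (f (+ suc T) + f -[1+ T ]) + f -[1+ suc T ] ∎
    where
    f′ : ℤ → ℤ
    f′ j = f (- j - + 1)
    mirror-pos : ∀ T → - + suc T - + 1 ≡ -[1+ suc T ]
    mirror-pos T = cong (λ k → -[1+ suc k ]) (ℕP.+-identityʳ T)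
    mirror-neg : ∀ T → - -[1+ T ] - + 1 ≡ + T
    mirror-neg T = trans (cong (_- + 1) (ℤP.pos-+ 1 T)) (peel (+ T))
      where
      peel : ∀ a → + 1 + a - + 1 ≡ a
      peel = solve-∀
    swap₁ : ∀ a b c d → a + (b + c) + d ≡ a + c + b + d
    swap₁ = solve-∀
    swap₂ : ∀ a b c d → a + b + c + d ≡ a + (d + b) + c
    swap₂ = solve-∀

  SupportedIn : ℕ → (ℤ → ℤ) → Set
  SupportedIn T f = ∀ j → T ℕ.< ∣ j ∣ → f j ≡ + 0

  symSum-extend : ∀ {T T′} (f : ℤ → ℤ) → T ℕ.≤ T′ → SupportedIn T f → symSum T′ f ≡ symSum T f
  symSum-extend {T′ = zero}   f z≤n vanish = refl
  symSum-extend {T′ = suc T′} f T≤T′ vanish with ℕP.m≤n⇒m<n∨m≡n T≤T′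
  ... | inj₂ refl      = refl
  ... | inj₁ (s≤s T≤) = trans
    (cong₂ _+_ (symSum-extend f T≤ vanish)
               (cong₂ _+_ (vanish (+ suc T′) (s≤s T≤)) (vanish -[1+ T′ ] (s≤s T≤))))
    (ℤP.+-identityʳ _)

  sumBelow : ℕ → (ℕ → ℤ) → ℤ
  sumBelow zero    φ = + 0
  sumBelow (suc k) φ = φ 0 + sumBelow k (φ ∘ suc)

  sumBelow-cong : ∀ k {φ ψ : ℕ → ℤ} → φ ≗ ψ → sumBelow k φ ≡ sumBelow k ψ
  sumBelow-cong zero    eq = refl
  sumBelow-cong (suc k) eq = cong₂ _+_ (eq 0) (sumBelow-cong k (eq ∘ suc))

  sumBelow-suc : ∀ k (φ : ℕ → ℤ) → sumBelow (suc k) φ ≡ sumBelow k φ + φ k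
  sumBelow-suc zero    φ = trans (ℤP.+-identityʳ (φ 0)) (sym (ℤP.+-identityˡ (φ 0)))
  sumBelow-suc (suc k) φ =
    trans (cong (λ z → φ 0 + z) (sumBelow-suc k (φ ∘ suc))) (sym (ℤP.+-assoc (φ 0) _ _))

  sumList-applyUpTo : ∀ k (h : ℕ → ℕ) (g : ℕ → ℤ) →
                      sumList (List.applyUpTo h k) g ≡ sumBelow k (g ∘ h)
  sumList-applyUpTo zero    h g = refl
  sumList-applyUpTo (suc k) h g = cong (λ z → g (h 0) + z) (sumList-applyUpTo k (h ∘ suc) g)

  sumBelow≡symSum : ∀ T (f : ℤ → ℤ) → sumBelow (suc (2 ℕ.* T)) (λ i → f (+ i - + T)) ≡ symSum T f
  sumBelow≡symSum zero    f = ℤP.+-identityʳ _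
  sumBelow≡symSum (suc T) f = begin
    sumBelow (suc (2 ℕ.* suc T)) φ
      ≡⟨ cong (λ k → sumBelow (suc k) φ) (ℕP.*-suc 2 T) ⟩
    φ 0 + sumBelow (suc (suc (2 ℕ.* T))) (φ ∘ suc)
      ≡⟨ cong (λ z → φ 0 + z) (sumBelow-suc (suc (2 ℕ.* T)) (φ ∘ suc)) ⟩
    φ 0 + (sumBelow (suc (2 ℕ.* T)) (φ ∘ suc) + φ (suc (suc (2 ℕ.* T))))
      ≡⟨ cong₂ (λ x y → φ 0 + (x + y))
           (trans (sumBelow-cong (suc (2 ℕ.* T)) (λ i → cong f (inner i))) (sumBelow≡symSum T f))
           (cong f top) ⟩
    f -[1+ T ] + (symSum T f + f (+ suc T))
      ≡⟨ rotate (f -[1+ T ]) (symSum T f) (f (+ suc T)) ⟩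
    symSum (suc T) f ∎
    where
    φ : ℕ → ℤ
    φ i = f (+ i - + suc T)
    inner : ∀ i → + suc i - + suc T ≡ + i - + T
    inner i = trans (cong₂ _-_ (ℤP.pos-+ 1 i) (ℤP.pos-+ 1 T)) (cancel (+ i) (+ T))
      where
      cancel : ∀ a b → + 1 + a - (+ 1 + b) ≡ a - b
      cancel = solve-∀
    top : + suc (suc (2 ℕ.* T)) - + suc T ≡ + suc T
    top = trans (cong (λ k → + k - + suc T) double)
                (trans (cong (_- + suc T) (ℤP.pos-+ (suc T) (suc T))) (cancel (+ suc T)))
      where
      double : suc (suc (2 ℕ.* T)) ≡ suc T ℕ.+ suc T
      double = cong suc (trans (cong (λ k → suc (T ℕ.+ k)) (ℕP.+-identityʳ T)) (sym (ℕP.+-suc T T)))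
      cancel : ∀ a → a + a - a ≡ a
      cancel = solve-∀
    rotate : ∀ a S c → a + (S + c) ≡ S + (c + a)
    rotate = solve-∀

  coeff-sumRange : ∀ T (f : ℤ → Poly) n → coeff (sumRange T f) n ≡ symSum T (λ j → coeff (f j) n)
  coeff-sumRange T f n = begin
    coeff (sumRange T f) n
      ≡⟨ coeff-foldr-⊕ (λ i → f (+ i - + T)) (List.upTo (suc (2 ℕ.* T))) n ⟩
    sumList (List.upTo (suc (2 ℕ.* T))) (λ i → coeff (f (+ i - + T)) n)
      ≡⟨ sumList-applyUpTo (suc (2 ℕ.* T)) (λ i → i) (λ i → coeff (f (+ i - + T)) n) ⟩
    sumBelow (suc (2 ℕ.* T)) (λ i → coeff (f (+ i - + T)) n)
      ≡⟨ sumBelow≡symSum T (λ j → coeff (f j) n) ⟩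
    symSum T (λ j → coeff (f j) n) ∎

  record HasSum (f : ℤ → ℤ) (x : ℤ) : Set where
    constructor hasSum
    field
      radius    : ℕ
      supported : SupportedIn radius f
      sum≡      : x ≡ symSum radius f

  ∣j∣≤1+∣-j-1∣ : ∀ j → ∣ j ∣ ℕ.≤ suc ∣ - j - + 1 ∣
  ∣j∣≤1+∣-j-1∣ j = ℕP.≤-trans (ℕP.≤-reflexive (cong ∣_∣ (unmirror j)))
    (ℕP.≤-trans (ℤP.∣i-j∣≤∣i∣+∣j∣ (- (- j - + 1)) (+ 1))
                (ℕP.≤-reflexive (trans (cong (ℕ._+ 1) (ℤP.∣-i∣≡∣i∣ (- j - + 1))) (ℕP.+-comm _ 1))))
    where
    unmirror : ∀ j → j ≡ - (- j - + 1) - + 1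
    unmirror = solve-∀

  module _ {f : ℤ → ℤ} {x : ℤ} (Σf : HasSum f x) where
    open HasSum Σf

    hasSum-symSum : ∀ {T} → radius ℕ.≤ T → x ≡ symSum T f
    hasSum-symSum r≤T = trans sum≡ (sym (symSum-extend f r≤T supported))

    hasSum-cong : ∀ {g} → f ≗ g → HasSum g x
    hasSum-cong f≗g = hasSum radius (λ j lt → trans (sym (f≗g j)) (supported j lt))
                                    (trans sum≡ (symSum-cong radius f≗g))

    hasSum-neg : HasSum (λ j → - f j) (- x)
    hasSum-neg = hasSum radius (λ j lt → cong -_ (supported j lt))
                               (trans (cong -_ sum≡) (sym (symSum-neg radius f)))

    hasSum-∘-neg : HasSum (f ∘ -_) x
    hasSum-∘-neg = hasSum radius (λ j lt → supported (- j) (subst (radius ℕ.<_) (sym (ℤP.∣-i∣≡∣i∣ j)) lt))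
                                 (trans sum≡ (sym (symSum-∘-neg radius f)))

    hasSum-∘-mirror : HasSum (λ j → f (- j - + 1)) x
    hasSum-∘-mirror = hasSum (suc radius) mirror-supported (begin
      x
        ≡⟨ hasSum-symSum (ℕP.n≤1+n radius) ⟩
      symSum (suc radius) f
        ≡⟨ sym (ℤP.+-identityʳ _) ⟩
      symSum (suc radius) f + + 0
        ≡⟨ cong (λ z → symSum (suc radius) f + z) (sym (supported -[1+ suc radius ] (s≤s (ℕP.n≤1+n _)))) ⟩
      symSum (suc radius) f + f -[1+ suc radius ]
        ≡⟨ sym (symSum-∘-mirror (suc radius) f) ⟩
      symSum (suc radius) f′ + f (+ suc radius)
        ≡⟨ cong (λ z → symSum (suc radius) f′ + z) (supported (+ suc radius) ℕP.≤-refl) ⟩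
      symSum (suc radius) f′ + + 0
        ≡⟨ ℤP.+-identityʳ _ ⟩
      symSum (suc radius) f′ ∎)
      where
      f′ : ℤ → ℤ
      f′ j = f (- j - + 1)
      mirror-supported : SupportedIn (suc radius) f′
      mirror-supported j lt = supported (- j - + 1) (ℕP.≤-pred (ℕP.≤-trans lt (∣j∣≤1+∣-j-1∣ j)))

  module _ {f g : ℤ → ℤ} {x y : ℤ} (Σf : HasSum f x) (Σg : HasSum g y) where
    private
      R : ℕ
      R = HasSum.radius Σf ℕ.+ HasSum.radius Σg
      f≤ : HasSum.radius Σf ℕ.≤ R
      f≤ = ℕP.m≤m+n _ _
      g≤ : HasSum.radius Σg ℕ.≤ R
      g≤ = ℕP.m≤n+m _ _

    hasSum-unique : f ≗ g → x ≡ y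
    hasSum-unique f≗g = trans (hasSum-symSum Σf f≤)
                              (trans (symSum-cong R f≗g) (sym (hasSum-symSum Σg g≤)))

    hasSum-+ : HasSum (λ j → f j + g j) (x + y)
    hasSum-+ = hasSum R
      (λ j lt → cong₂ _+_ (HasSum.supported Σf j (ℕP.≤-<-trans f≤ lt))
                          (HasSum.supported Σg j (ℕP.≤-<-trans g≤ lt)))
      (trans (cong₂ _+_ (hasSum-symSum Σf f≤) (hasSum-symSum Σg g≤)) (sym (symSum-+ R f g)))

  hasSum-- : ∀ {f g x y} → HasSum f x → HasSum g y → HasSum (λ j → f j - g j) (x - y)
  hasSum-- Σf Σg = hasSum-+ Σf (hasSum-neg Σg)

  hasSum-single : ∀ (f : ℤ → ℤ) → (∀ j → j ≢ + 0 → f j ≡ + 0) → HasSum f (f (+ 0))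
  hasSum-single f vanish =
    hasSum 0 (λ j lt → vanish j (λ { refl → ℕP.<-irrefl refl lt })) refl

  hasSum-antisymmetric : ∀ {x} (Y : ℤ → ℤ) → HasSum (λ j → Y (- j) - Y j) x → x ≡ + 0
  hasSum-antisymmetric Y (hasSum T _ x≡) =
    trans x≡ (trans (symSum-- T (Y ∘ -_) Y)
                    (trans (cong (_- symSum T Y) (symSum-∘-neg T Y)) (ℤP.+-inverseʳ (symSum T Y))))

  -- Gaussian coefficients

  gauss : ℕ → ℤ → ℤ → ℤ
  gauss L k n = coeff (qbin L k) n

  -- coefficient of q^n in (1 - q^L) f
  Δ : ℕ → (ℤ → ℤ) → ℤ → ℤ
  Δ L f n = f n - f (n - + L)

  Δ-zero : ∀ (f : ℤ → ℤ) n → Δ 0 f n ≡ + 0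
  Δ-zero f n = trans (cong (λ m → f n - f m) (ℤP.+-identityʳ n)) (ℤP.+-inverseʳ (f n))

  Δ-cong : ∀ L {f g : ℤ → ℤ} → (0 ℕ.< L → f ≗ g) → Δ L f ≗ Δ L g
  Δ-cong zero    {f} {g} _   n = trans (Δ-zero f n) (sym (Δ-zero g n))
  Δ-cong (suc L) f≗g n = cong₂ _-_ (f≗g (s≤s z≤n) n) (f≗g (s≤s z≤n) (n - + suc L))

  Δ-shift : ∀ L (g : ℤ → ℤ) e n → Δ L (λ m → g (m - e)) n ≡ Δ L g (n - e)
  Δ-shift L g e n = cong (λ z → g (n - e) - g z) (swap n (+ L) e)
    where
    swap : ∀ n l e → n - l - e ≡ n - e - l
    swap = solve-∀

  gauss-cong : ∀ L {k k′ n n′} → k ≡ k′ → n ≡ n′ → gauss L k n ≡ gauss L k′ n′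
  gauss-cong L refl refl = refl

  gauss-pascal : ∀ L k n → gauss (suc L) k n ≡ gauss L (k - + 1) n + gauss L k (n - k)
  gauss-pascal L k n = trans (coeff-⊕ (qbin L (k - + 1)) (shift k (qbin L k)) n)
                             (cong (λ z → gauss L (k - + 1) n + z) (coeff-shift k (qbin L k) n))

  gauss-0-nonzero : ∀ {k} n → k ≢ + 0 → gauss 0 k n ≡ + 0
  gauss-0-nonzero {+ zero}    n k≢0 = ⊥-elim (k≢0 refl)
  gauss-0-nonzero {+ suc _}   n _   = refl
  gauss-0-nonzero { -[1+ _ ]} n _   = refl

  gauss-0-shift : ∀ k n e → (k ≡ + 0 → e ≡ + 0) → gauss 0 k (n - e) ≡ gauss 0 k n
  gauss-0-shift k n e e≡0 with k ℤ.≟ + 0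
  ... | yes refl = cong (gauss 0 (+ 0)) (trans (cong (λ z → n - z) (e≡0 refl)) (ℤP.+-identityʳ n))
  ... | no k≢0   = trans (gauss-0-nonzero (n - e) k≢0) (sym (gauss-0-nonzero n k≢0))

  gauss-pascal′ : ∀ L k n → gauss (suc L) k n ≡ gauss L (k - + 1) (n - (+ suc L - k)) + gauss L k n
  gauss-pascal′ zero k n = trans (gauss-pascal 0 k n)
    (cong₂ _+_ (sym (gauss-0-shift (k - + 1) n (+ 1 - k) λ eq → trans (negate k) (cong -_ eq)))
               (gauss-0-shift k n k (λ eq → eq)))
    where
    negate : ∀ k → + 1 - k ≡ - (k - + 1)
    negate = solve-∀
  gauss-pascal′ (suc L) k n = begin
    gauss (suc (suc L)) k n
      ≡⟨ gauss-pascal (suc L) k n ⟩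
    gauss (suc L) (k - + 1) n + gauss (suc L) k (n - k)
      ≡⟨ cong₂ _+_ (gauss-pascal′ L (k - + 1) n) (gauss-pascal′ L k (n - k)) ⟩
    (gauss L (k - + 1 - + 1) (n - (l - (k - + 1))) + gauss L (k - + 1) n)
      + (gauss L (k - + 1) (n - k - (l - k)) + gauss L k (n - k))
      ≡⟨ cong₂ (λ u v → (gauss L (k - + 1 - + 1) u + gauss L (k - + 1) n)
                        + (gauss L (k - + 1) v + gauss L k (n - k)))
               (exp₁ n l k) (exp₂ n l k) ⟩
    (gauss L (k - + 1 - + 1) m + gauss L (k - + 1) n)
      + (gauss L (k - + 1) (m - (k - + 1)) + gauss L k (n - k))
      ≡⟨ swap (gauss L (k - + 1 - + 1) m) (gauss L (k - + 1) n)
              (gauss L (k - + 1) (m - (k - + 1))) (gauss L k (n - k)) ⟩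
    (gauss L (k - + 1 - + 1) m + gauss L (k - + 1) (m - (k - + 1)))
      + (gauss L (k - + 1) n + gauss L k (n - k))
      ≡⟨ sym (cong₂ _+_ (gauss-pascal L (k - + 1) m) (gauss-pascal L k n)) ⟩
    gauss (suc L) (k - + 1) m + gauss (suc L) k n
      ≡⟨ cong (λ z → gauss (suc L) (k - + 1) (n - (z - k)) + gauss (suc L) k n)
              (sym (ℤP.pos-+ 1 (suc L))) ⟩
    gauss (suc L) (k - + 1) (n - (+ suc (suc L) - k)) + gauss (suc L) k n ∎
    where
    l : ℤ
    l = + suc L
    m : ℤ
    m = n - (+ 1 + l - k)
    exp₁ : ∀ n l k → n - (l - (k - + 1)) ≡ n - (+ 1 + l - k)
    exp₁ = solve-∀
    exp₂ : ∀ n l k → n - k - (l - k) ≡ n - (+ 1 + l - k) - (k - + 1)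
    exp₂ = solve-∀
    swap : ∀ a b c d → (a + b) + (c + d) ≡ (a + c) + (b + d)
    swap = solve-∀

  gauss-symmetric : ∀ L k n → gauss L k n ≡ gauss L (+ L - k) n
  gauss-symmetric zero (+ zero)    n = refl
  gauss-symmetric zero (+ suc _)   n = refl
  gauss-symmetric zero -[1+ _ ]    n = refl
  gauss-symmetric (suc L) k n = begin
    gauss (suc L) k n
      ≡⟨ gauss-pascal L k n ⟩
    gauss L (k - + 1) n + gauss L k (n - k)
      ≡⟨ cong₂ _+_ (gauss-symmetric L (k - + 1) n) (gauss-symmetric L k (n - k)) ⟩
    gauss L (+ L - (k - + 1)) n + gauss L (+ L - k) (n - k)
      ≡⟨ ℤP.+-comm (gauss L (+ L - (k - + 1)) n) (gauss L (+ L - k) (n - k)) ⟩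
    gauss L (+ L - k) (n - k) + gauss L (+ L - (k - + 1)) n
      ≡⟨ cong₂ _+_ (gauss-cong L (idx₁ (+ L) k) (idx₂ n (+ L) k)) (gauss-cong L (idx₃ (+ L) k) refl) ⟩
    gauss L (l′ - k - + 1) (n - (l′ - (l′ - k))) + gauss L (l′ - k) n
      ≡⟨ cong (λ z → gauss L (z - k - + 1) (n - (z - (z - k))) + gauss L (z - k) n)
              (sym (ℤP.pos-+ 1 L)) ⟩
    gauss L (+ suc L - k - + 1) (n - (+ suc L - (+ suc L - k))) + gauss L (+ suc L - k) n
      ≡⟨ sym (gauss-pascal′ L (+ suc L - k) n) ⟩
    gauss (suc L) (+ suc L - k) n ∎
    where
    l′ : ℤ
    l′ = + 1 + + L
    idx₁ : ∀ l k → l - k ≡ + 1 + l - k - + 1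
    idx₁ = solve-∀
    idx₂ : ∀ n l k → n - k ≡ n - (+ 1 + l - (+ 1 + l - k))
    idx₂ = solve-∀
    idx₃ : ∀ l k → l - (k - + 1) ≡ + 1 + l - k
    idx₃ = solve-∀

  -- for L = 0 the Δ term vanishes, so the truncated L ∸ 1 does no harm
  gauss-recurrence : ∀ L k n →
    gauss (suc L) k n ≡ gauss L k n + gauss L (k - + 1) n - Δ L (gauss (L ℕ.∸ 1) (k - + 1)) n
  gauss-recurrence zero k n = begin
    gauss 1 k n
      ≡⟨ gauss-pascal 0 k n ⟩
    gauss 0 (k - + 1) n + gauss 0 k (n - k)
      ≡⟨ cong (λ z → gauss 0 (k - + 1) n + z) (gauss-0-shift k n k (λ eq → eq)) ⟩
    gauss 0 (k - + 1) n + gauss 0 k n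
      ≡⟨ ℤP.+-comm (gauss 0 (k - + 1) n) (gauss 0 k n) ⟩
    gauss 0 k n + gauss 0 (k - + 1) n
      ≡⟨ sym (ℤP.+-identityʳ _) ⟩
    gauss 0 k n + gauss 0 (k - + 1) n - + 0
      ≡⟨ cong (λ z → gauss 0 k n + gauss 0 (k - + 1) n - z) (sym (Δ-zero (gauss 0 (k - + 1)) n)) ⟩
    gauss 0 k n + gauss 0 (k - + 1) n - Δ 0 (gauss 0 (k - + 1)) n ∎
  gauss-recurrence (suc L) k n = begin
    gauss (suc (suc L)) k n
      ≡⟨ gauss-pascal (suc L) k n ⟩
    gauss (suc L) (k - + 1) n + gauss (suc L) k (n - k)
      ≡⟨ cong (λ z → gauss (suc L) (k - + 1) n + z) (gauss-pascal′ L k (n - k)) ⟩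
    gauss (suc L) (k - + 1) n + (gauss L (k - + 1) (n - k - (+ suc L - k)) + gauss L k (n - k))
      ≡⟨ cong (λ z → gauss (suc L) (k - + 1) n + (gauss L (k - + 1) z + gauss L k (n - k))) (exp n (+ suc L) k) ⟩
    gauss (suc L) (k - + 1) n + (gauss L (k - + 1) (n - + suc L) + gauss L k (n - k))
      ≡⟨ rearrange (gauss (suc L) (k - + 1) n) (gauss L (k - + 1) (n - + suc L))
                   (gauss L k (n - k)) (gauss L (k - + 1) n) ⟩
    (gauss L (k - + 1) n + gauss L k (n - k)) + gauss (suc L) (k - + 1) n - Δ (suc L) (gauss L (k - + 1)) n
      ≡⟨ cong (λ z → z + gauss (suc L) (k - + 1) n - Δ (suc L) (gauss L (k - + 1)) n) (sym (gauss-pascal L k n)) ⟩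
    gauss (suc L) k n + gauss (suc L) (k - + 1) n - Δ (suc L) (gauss L (k - + 1)) n ∎
    where
    exp : ∀ n l k → n - k - (l - k) ≡ n - l
    exp = solve-∀
    rearrange : ∀ a b c d → a + (b + c) ≡ (d + c) + a - (d - b)
    rearrange = solve-∀

  gauss-Δ : ∀ L k n → gauss L k n - Δ L (gauss (L ℕ.∸ 1) k) n ≡ gauss L k (n - (+ L - k))
  gauss-Δ zero k n = begin
    gauss 0 k n - Δ 0 (gauss 0 k) n  ≡⟨ cong (λ z → gauss 0 k n - z) (Δ-zero (gauss 0 k) n) ⟩
    gauss 0 k n - + 0                ≡⟨ ℤP.+-identityʳ _ ⟩
    gauss 0 k n                      ≡⟨ sym (gauss-0-shift k n (+ 0 - k) (cong (λ z → + 0 - z))) ⟩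
    gauss 0 k (n - (+ 0 - k))        ∎
  gauss-Δ (suc L) k n = begin
    gauss (suc L) k n - Δ (suc L) (gauss L k) n
      ≡⟨ cong (λ z → z - Δ (suc L) (gauss L k) n) (gauss-pascal′ L k n) ⟩
    gauss L (k - + 1) (n - (+ suc L - k)) + gauss L k n - Δ (suc L) (gauss L k) n
      ≡⟨ cancel (gauss L (k - + 1) (n - (+ suc L - k))) (gauss L k n) (gauss L k (n - + suc L)) ⟩
    gauss L (k - + 1) (n - (+ suc L - k)) + gauss L k (n - + suc L)
      ≡⟨ cong (λ z → gauss L (k - + 1) (n - (+ suc L - k)) + gauss L k z) (exp n (+ suc L) k) ⟩
    gauss L (k - + 1) (n - (+ suc L - k)) + gauss L k (n - (+ suc L - k) - k)
      ≡⟨ sym (gauss-pascal L k (n - (+ suc L - k))) ⟩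
    gauss (suc L) k (n - (+ suc L - k)) ∎
    where
    exp : ∀ n l k → n - l ≡ n - (l - k) - k
    exp = solve-∀
    cancel : ∀ a b c → a + b - (b - c) ≡ a + c
    cancel = solve-∀

  gauss-vanish : ∀ L {k} n → L ℕ.< ∣ k ∣ → gauss L k n ≡ + 0
  gauss-vanish zero {+ zero}    n ()
  gauss-vanish zero {+ suc _}   n _ = refl
  gauss-vanish zero { -[1+ _ ]} n _ = refl
  gauss-vanish (suc L) {k} n L<∣k∣ = begin
    gauss (suc L) k n                        ≡⟨ gauss-pascal L k n ⟩
    gauss L (k - + 1) n + gauss L k (n - k)  ≡⟨ cong₂ _+_ (gauss-vanish L n L<∣k-1∣)
                                                         (gauss-vanish L (n - k) (ℕP.<-trans (ℕP.n<1+n L) L<∣k∣)) ⟩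
    + 0 + + 0                                ∎
    where
    ∣k∣≤ : ∣ k ∣ ℕ.≤ suc ∣ k - + 1 ∣
    ∣k∣≤ = ℕP.≤-trans (ℕP.≤-reflexive (cong ∣_∣ (restore k)))
             (ℕP.≤-trans (ℤP.∣i+j∣≤∣i∣+∣j∣ (k - + 1) (+ 1)) (ℕP.≤-reflexive (ℕP.+-comm ∣ k - + 1 ∣ 1)))
      where
      restore : ∀ k → k ≡ k - + 1 + + 1
      restore = solve-∀
    L<∣k-1∣ : L ℕ.< ∣ k - + 1 ∣
    L<∣k-1∣ = ℕP.≤-pred (ℕP.≤-trans L<∣k∣ ∣k∣≤)

  -- Halving

  Even : ℤ → Set
  Even x = Σ ℤ λ a → x ≡ + 2 * a

  even-+2* : ∀ {x} y → Even x → Even (x + + 2 * y)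
  even-+2* y (a , refl) = a + y , sym (ℤP.*-distribˡ-+ (+ 2) a y)

  even-shift : ∀ {x y} k → Even x → y ≡ x + + 2 * k → Even y
  even-shift k ev y≡ = subst Even (sym y≡) (even-+2* k ev)

  divmod2 : ∀ n → + n ≡ + (n % 2) + + 2 * + (n / 2)
  divmod2 n = trans (cong +_ (m≡m%n+[m/n]*n n 2)) (trans (ℤP.pos-+ (n % 2) _)
    (cong (λ z → + (n % 2) + z) (trans (ℤP.pos-* (n / 2) 2) (ℤP.*-comm (+ (n / 2)) (+ 2)))))

  same-parity⇒even : ∀ n k → n % 2 ≡ k % 2 → Even (+ n - + k)
  same-parity⇒even n k eq = + (n / 2) - + (k / 2) , (begin
    + n - + k                                             ≡⟨ cong₂ _-_ (divmod2 n) (divmod2 k) ⟩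
    + (n % 2) + + 2 * + (n / 2) - (+ (k % 2) + + 2 * + (k / 2))
      ≡⟨ cong (λ r → + r + + 2 * + (n / 2) - (+ (k % 2) + + 2 * + (k / 2))) eq ⟩
    + (k % 2) + + 2 * + (n / 2) - (+ (k % 2) + + 2 * + (k / 2)) ≡⟨ cancel (+ (k % 2)) (+ (n / 2)) (+ (k / 2)) ⟩
    + 2 * (+ (n / 2) - + (k / 2))                          ∎)
    where
    cancel : ∀ r a b → r + + 2 * a - (r + + 2 * b) ≡ + 2 * (a - b)
    cancel = solve-∀

  different-parity⇒odd : ∀ n k → n % 2 ≢ k % 2 → Even (+ n - + k - + 1)
  different-parity⇒odd n k neq =
    odd (n % 2) (k % 2) {+ (n / 2)} {+ (k / 2)} (m%n<n n 2) (m%n<n k 2) neq (divmod2 n) (divmod2 k)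
    where
    odd : ∀ r r′ {a a′} → r ℕ.< 2 → r′ ℕ.< 2 → r ≢ r′ →
          + n ≡ + r + + 2 * a → + k ≡ + r′ + + 2 * a′ → Even (+ n - + k - + 1)
    odd 0 0 _ _ r≢r′ _ _ = ⊥-elim (r≢r′ refl)
    odd 1 1 _ _ r≢r′ _ _ = ⊥-elim (r≢r′ refl)
    odd 1 0 {a} {a′} _ _ _ n≡ k≡ = a - a′ , trans (cong₂ (λ x y → x - y - + 1) n≡ k≡) (rearrange a a′)
      where
      rearrange : ∀ a a′ → + 1 + + 2 * a - (+ 0 + + 2 * a′) - + 1 ≡ + 2 * (a - a′)
      rearrange = solve-∀
    odd 0 1 {a} {a′} _ _ _ n≡ k≡ = a - a′ - + 1 , trans (cong₂ (λ x y → x - y - + 1) n≡ k≡) (rearrange a a′)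
      where
      rearrange : ∀ a a′ → + 0 + + 2 * a - (+ 1 + + 2 * a′) - + 1 ≡ + 2 * (a - a′ - + 1)
      rearrange = solve-∀
    odd (suc (suc _)) _ (s≤s (s≤s ())) _ _ _ _
    odd _ (suc (suc _)) _ (s≤s (s≤s ())) _ _ _

  2*≢1 : ∀ m → 2 ℕ.* m ≢ 1
  2*≢1 (suc m) eq = ℕP.m+1+n≢0 m (ℕP.suc-injective eq)

  even≢odd : ∀ a b → + 2 * a ≢ + 2 * b + + 1
  even≢odd a b eq = 2*≢1 ∣ a - b ∣ (trans (sym (ℤP.abs-* (+ 2) (a - b))) (cong ∣_∣ 2[a-b]≡1))
    where
    2[a-b]≡1 : + 2 * (a - b) ≡ + 1
    2[a-b]≡1 = trans (distrib a b) (trans (cong (_- + 2 * b) eq) (cancel b))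
      where
      distrib : ∀ a b → + 2 * (a - b) ≡ + 2 * a - + 2 * b
      distrib = solve-∀
      cancel : ∀ b → + 2 * b + + 1 - + 2 * b ≡ + 1
      cancel = solve-∀

  HalfOf : ℤ → ℤ → Set
  HalfOf x h = x ≡ + 2 * h ⊎ x ≡ + 2 * h + + 1

  half-spec : ∀ x → HalfOf x (half x)
  half-spec x = from-divmod (x ℤ./ℕ 2) (ℤD.n%ℕd<d x 2) (ℤD.a≡a%ℕn+[a/ℕn]*n x 2)
    where
    from-divmod : ∀ h {r} → r ℕ.< 2 → x ≡ + r + h * + 2 → HalfOf x h
    from-divmod h {0}     _ eq = inj₁ (trans eq (reorder₀ h))
      where
      reorder₀ : ∀ h → + 0 + h * + 2 ≡ + 2 * h
      reorder₀ = solve-∀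
    from-divmod h {1}     _ eq = inj₂ (trans eq (reorder₁ h))
      where
      reorder₁ : ∀ h → + 1 + h * + 2 ≡ + 2 * h + + 1
      reorder₁ = solve-∀
    from-divmod h {suc (suc _)} (s≤s (s≤s ())) _

  half-unique : ∀ {x h} → HalfOf x h → half x ≡ h
  half-unique {x} {h} hx with hx | half-spec x
  ... | inj₁ p | inj₁ q = ℤP.*-cancelˡ-≡ (+ 2) _ _ (trans (sym q) p)
  ... | inj₂ p | inj₂ q = ℤP.*-cancelˡ-≡ (+ 2) _ _ (+1-injective (trans (sym q) p))
    where
    +1-injective : ∀ {a b} → a + + 1 ≡ b + + 1 → a ≡ b
    +1-injective {a} {b} eq = trans (restore a) (trans (cong (_- + 1) eq) (sym (restore b)))
      where
      restore : ∀ a → a ≡ a + + 1 - + 1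
      restore = solve-∀
  ... | inj₁ p | inj₂ q = ⊥-elim (even≢odd h (half x) (trans (sym p) q))
  ... | inj₂ p | inj₁ q = ⊥-elim (even≢odd (half x) h (trans (sym q) p))

  half-even : ∀ {x a} → x ≡ + 2 * a → half x ≡ a
  half-even eq = half-unique (inj₁ eq)

  half-+2* : ∀ x y → half (x + + 2 * y) ≡ half x + y
  half-+2* x y with half-spec x
  ... | inj₁ p = half-unique (inj₁ (trans (cong (_+ + 2 * y) p) (even (half x) y)))
    where
    even : ∀ h y → + 2 * h + + 2 * y ≡ + 2 * (h + y)
    even = solve-∀
  ... | inj₂ p = half-unique (inj₂ (trans (cong (_+ + 2 * y) p) (odd (half x) y)))
    where
    odd : ∀ h y → + 2 * h + + 1 + + 2 * y ≡ + 2 * (h + y) + + 1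
    odd = solve-∀

  half-pred₂ : ∀ x → half (x - + 2) ≡ half x - + 1
  half-pred₂ x = half-+2* x (- + 1)

  ∣half∣≤ : ∀ x → ∣ half x ∣ ℕ.≤ suc ∣ x ∣
  ∣half∣≤ x = ℕP.≤-trans (ℕP.m≤m+n ∣ half x ∣ (∣ half x ∣ ℕ.+ 0))
                (ℕP.≤-trans (ℕP.≤-reflexive (sym (ℤP.abs-* (+ 2) (half x)))) (bound (half-spec x)))
    where
    bound : HalfOf x (half x) → ∣ + 2 * half x ∣ ℕ.≤ suc ∣ x ∣
    bound (inj₁ p) = ℕP.≤-trans (ℕP.≤-reflexive (cong ∣_∣ (sym p))) (ℕP.n≤1+n _)
    bound (inj₂ p) = ℕP.≤-trans (ℕP.≤-reflexive (cong ∣_∣ (trans (restore (half x)) (cong (_- + 1) (sym p)))))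
                       (ℕP.≤-trans (ℤP.∣i-j∣≤∣i∣+∣j∣ x (+ 1)) (ℕP.≤-reflexive (ℕP.+-comm ∣ x ∣ 1)))
      where
      restore : ∀ h → + 2 * h ≡ + 2 * h + + 1 - + 1
      restore = solve-∀

  -- |j| K - |h| ≥ 2 (M + 2) - (M + 1) > M
  index-large : ∀ {L M K h j} → ∣ h ∣ ℕ.≤ suc M → L ℕ.≤ M → suc (suc M) ℕ.≤ ∣ j ∣ → 2 ℕ.≤ K →
                L ℕ.< ∣ h + j * + K ∣
  index-large {L} {M} {K} {h} {j} ∣h∣≤ L≤M ∣j∣≥ 2≤K = ℕP.≰⇒> λ A≤L →
    ℕP.<-irrefl refl (ℕP.<-≤-trans (ℕP.m<n+m (M ℕ.+ suc M) {3} (s≤s z≤n))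
      (ℕP.≤-trans (ℕP.≤-reflexive (sym (expand M))) (ℕP.≤-trans 2[M+2]≤∣j∣K
        (ℕP.≤-trans ∣j∣K≤ (ℕP.+-mono-≤ (ℕP.≤-trans A≤L L≤M) ∣h∣≤)))))
    where
    expand : ∀ M → suc (suc M) ℕ.* 2 ≡ 3 ℕ.+ (M ℕ.+ suc M)
    expand = ℕRing.solve-∀
    2[M+2]≤∣j∣K : suc (suc M) ℕ.* 2 ℕ.≤ ∣ j ∣ ℕ.* K
    2[M+2]≤∣j∣K = ℕP.*-mono-≤ ∣j∣≥ 2≤K
    ∣j∣K≤ : ∣ j ∣ ℕ.* K ℕ.≤ ∣ h + j * + K ∣ ℕ.+ ∣ h ∣
    ∣j∣K≤ = ℕP.≤-trans (ℕP.≤-reflexive (trans (sym (ℤP.abs-* j (+ K))) (cong ∣_∣ (restore h (j * + K)))))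
                       (ℤP.∣i-j∣≤∣i∣+∣j∣ (h + j * + K) h)
      where
      restore : ∀ h u → u ≡ h + u - h
      restore = solve-∀

  -- The alternating sums B

  module BSum (ν : ℕ) where

    K′ : ℕ
    K′ = 2 ℕ.* ν ℕ.+ 3

    K : ℤ
    K = + K′

    2≤K : 2 ℕ.≤ K′
    2≤K = ℕP.≤-trans (s≤s (s≤s z≤n)) (ℕP.m≤n+m 3 (2 ℕ.* ν))

    expA expB : ℤ → ℤ → ℤ
    expA σ j = j * ((+ 2 * j + + 1) * K - + 2 * σ)
    expB σ j = (+ 2 * j + + 1) * (K * j + σ)

    -- the two terms of B are the cases τ = -σ and τ = σ
    piece : ℤ → ℤ → ℤ → ℕ → ℤ → ℤ → ℤ
    piece τ β e L j n = gauss L (half (+ L + β + τ) + j * K) (n - e)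

    termA termB term : ℤ → ℤ → ℕ → ℤ → ℤ → ℤ
    termA σ β L j n = piece (- σ) β (expA σ j) L j n
    termB σ β L j n = piece σ β (expB σ j) L j n
    term σ β L j n = termA σ β L j n - termB σ β L j n

    Bc : ℤ → ℤ → ℕ → ℤ → ℤ
    Bc σ β L n = coeff (Bfun ν σ β L) n

    cutoff : ℤ → ℤ → ℕ → ℕ
    cutoff σ β L = L ℕ.+ ∣ σ ∣ ℕ.+ ∣ β ∣ ℕ.+ 1

    piece-vanish : ∀ τ β e L j n → L ℕ.+ ∣ τ ∣ ℕ.+ ∣ β ∣ ℕ.+ 1 ℕ.< ∣ j ∣ → piece τ β e L j n ≡ + 0
    piece-vanish τ β e L j n r<∣j∣ = gauss-vanish L (n - e) (index-large {h = half (+ L + β + τ)} {j = j}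
      (ℕP.≤-trans (∣half∣≤ (+ L + β + τ)) (s≤s ∣N∣≤))
      (ℕP.≤-trans (ℕP.m≤m+n L ∣ τ ∣) (ℕP.m≤m+n _ ∣ β ∣))
      (ℕP.≤-trans (ℕP.≤-reflexive (cong suc (ℕP.+-comm 1 _))) r<∣j∣)
      2≤K)
      where
      ∣N∣≤ : ∣ + L + β + τ ∣ ℕ.≤ L ℕ.+ ∣ τ ∣ ℕ.+ ∣ β ∣
      ∣N∣≤ = ℕP.≤-trans (ℤP.∣i+j∣≤∣i∣+∣j∣ (+ L + β) τ)
               (ℕP.≤-trans (ℕP.+-monoˡ-≤ ∣ τ ∣ (ℤP.∣i+j∣≤∣i∣+∣j∣ (+ L) β))
                           (ℕP.≤-reflexive (reorder L ∣ β ∣ ∣ τ ∣)))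
        where
        reorder : ∀ a b c → a ℕ.+ b ℕ.+ c ≡ a ℕ.+ c ℕ.+ b
        reorder = ℕRing.solve-∀

    ΣA ΣB : ℤ → ℤ → ℕ → ℤ → ℤ
    ΣA σ β L n = symSum (cutoff σ β L) (λ j → termA σ β L j n)
    ΣB σ β L n = symSum (cutoff σ β L) (λ j → termB σ β L j n)

    hasSum-termA : ∀ σ β L n → HasSum (λ j → termA σ β L j n) (ΣA σ β L n)
    hasSum-termA σ β L n = hasSum (cutoff σ β L) (λ j lt → piece-vanish (- σ) β (expA σ j) L j n
      (subst (λ a → L ℕ.+ a ℕ.+ ∣ β ∣ ℕ.+ 1 ℕ.< ∣ j ∣) (sym (ℤP.∣-i∣≡∣i∣ σ)) lt)) refl

    hasSum-termB : ∀ σ β L n → HasSum (λ j → termB σ β L j n) (ΣB σ β L n)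
    hasSum-termB σ β L n = hasSum (cutoff σ β L) (λ j → piece-vanish σ β (expB σ j) L j n) refl

    coeff-Bfun : ∀ σ β L n → Bc σ β L n ≡ ΣA σ β L n - ΣB σ β L n
    coeff-Bfun σ β L n = begin
      Bc σ β L n                                        ≡⟨ coeff-sumRange (cutoff σ β L) F n ⟩
      symSum (cutoff σ β L) (λ j → coeff (F j) n)       ≡⟨ symSum-cong (cutoff σ β L) coeff-F ⟩
      symSum (cutoff σ β L) (λ j → term σ β L j n)      ≡⟨ symSum-- (cutoff σ β L) _ _ ⟩
      ΣA σ β L n - ΣB σ β L n                           ∎
      where
      F : ℤ → Poly
      F j = shift (expA σ j) (qbin L (half (+ L + β - σ) + j * K))
            ⊕ (⊖ shift (expB σ j) (qbin L (half (+ L + β + σ) + j * K)))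
      coeff-F : ∀ j → coeff (F j) n ≡ term σ β L j n
      coeff-F j = trans (coeff-⊕ (shift (expA σ j) qa) (⊖ shift (expB σ j) qb) n)
        (cong₂ _+_ (coeff-shift (expA σ j) qa n)
                   (trans (coeff-⊖ (shift (expB σ j) qb) n) (cong -_ (coeff-shift (expB σ j) qb n))))
        where
        qa : Poly
        qa = qbin L (half (+ L + β - σ) + j * K)
        qb : Poly
        qb = qbin L (half (+ L + β + σ) + j * K)

    hasSum-Bc : ∀ σ β L n → HasSum (λ j → term σ β L j n) (Bc σ β L n)
    hasSum-Bc σ β L n = subst (HasSum _) (sym (coeff-Bfun σ β L n))
                              (hasSum-- (hasSum-termA σ β L n) (hasSum-termB σ β L n))

    hasSum-ΔBc : ∀ σ β L L′ n → HasSum (λ j → Δ L (term σ β L′ j) n) (Δ L (Bc σ β L′) n)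
    hasSum-ΔBc σ β L L′ n = hasSum-- (hasSum-Bc σ β L′ n) (hasSum-Bc σ β L′ (n - + L))

    index-pred : ∀ x {y} j → y ≡ x - + 2 → half y + j * K ≡ half x + j * K - + 1
    index-pred x j refl = trans (cong (_+ j * K) (half-pred₂ x)) (swap (half x) (j * K))
      where
      swap : ∀ h u → h - + 1 + u ≡ h + u - + 1
      swap = solve-∀

    piece-lower : ∀ τ β e L j m → 0 ℕ.< L →
      piece τ β e (L ℕ.∸ 1) j m ≡ gauss (L ℕ.∸ 1) (half (+ suc L + β + τ) + j * K - + 1) (m - e)
    piece-lower τ β e (suc L) j m _ = cong (λ x → gauss L x (m - e)) (index-pred (+ suc (suc L) + β + τ) j
      (trans (reassoc (+ L) β τ) (cong (λ l → l + β + τ - + 2) (sym (ℤP.pos-+ 2 L)))))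
      where
      reassoc : ∀ l β τ → l + β + τ ≡ + 2 + l + β + τ - + 2
      reassoc = solve-∀

    piece-recurrence : ∀ τ β e L j n →
      piece τ β e (suc L) j n ≡
      piece τ (β + + 1) e L j n + piece τ (β - + 1) e L j n - Δ L (piece τ β e (L ℕ.∸ 1) j) n
    piece-recurrence τ β e L j n = begin
      gauss (suc L) k (n - e)
        ≡⟨ gauss-recurrence L k (n - e) ⟩
      gauss L k (n - e) + gauss L (k - + 1) (n - e) - Δ L (gauss (L ℕ.∸ 1) (k - + 1)) (n - e)
        ≡⟨ cong₂ (λ u v → gauss L u (n - e) + gauss L v (n - e) - Δ L (gauss (L ℕ.∸ 1) (k - + 1)) (n - e))
                 (cong (λ x → half x + j * K) (sym same-numerator)) (sym (index-pred N j pred-numerator)) ⟩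
      piece τ (β + + 1) e L j n + piece τ (β - + 1) e L j n - Δ L (gauss (L ℕ.∸ 1) (k - + 1)) (n - e)
        ≡⟨ cong (λ z → piece τ (β + + 1) e L j n + piece τ (β - + 1) e L j n - z) (sym Δ-term) ⟩
      piece τ (β + + 1) e L j n + piece τ (β - + 1) e L j n - Δ L (piece τ β e (L ℕ.∸ 1) j) n ∎
      where
      N : ℤ
      N = + suc L + β + τ
      k : ℤ
      k = half N + j * K
      same-numerator : + L + (β + + 1) + τ ≡ N
      same-numerator = trans (reassoc (+ L) β τ) (cong (λ l → l + β + τ) (sym (ℤP.pos-+ 1 L)))
        where
        reassoc : ∀ l β τ → l + (β + + 1) + τ ≡ + 1 + l + β + τ
        reassoc = solve-∀
      pred-numerator : + L + (β - + 1) + τ ≡ N - + 2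
      pred-numerator = trans (reassoc (+ L) β τ) (cong (λ l → l + β + τ - + 2) (sym (ℤP.pos-+ 1 L)))
        where
        reassoc : ∀ l β τ → l + (β - + 1) + τ ≡ + 1 + l + β + τ - + 2
        reassoc = solve-∀
      Δ-term : Δ L (piece τ β e (L ℕ.∸ 1) j) n ≡ Δ L (gauss (L ℕ.∸ 1) (k - + 1)) (n - e)
      Δ-term = trans (Δ-cong L (λ 0<L m → piece-lower τ β e L j m 0<L) n)
                     (Δ-shift L (gauss (L ℕ.∸ 1) (k - + 1)) e n)

    term-recurrence : ∀ σ β L j n → term σ β (suc L) j n ≡
      term σ (β + + 1) L j n + term σ (β - + 1) L j n - Δ L (term σ β (L ℕ.∸ 1) j) n
    term-recurrence σ β L j n = trans
      (cong₂ _-_ (piece-recurrence (- σ) β (expA σ j) L j n) (piece-recurrence σ β (expB σ j) L j n))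
      (regroup (termA σ (β + + 1) L j n) (termA σ (β - + 1) L j n)
               (termA σ β (L ℕ.∸ 1) j n) (termA σ β (L ℕ.∸ 1) j (n - + L))
               (termB σ (β + + 1) L j n) (termB σ (β - + 1) L j n)
               (termB σ β (L ℕ.∸ 1) j n) (termB σ β (L ℕ.∸ 1) j (n - + L)))
      where
      regroup : ∀ a b c d a′ b′ c′ d′ → (a + b - (c - d)) - (a′ + b′ - (c′ - d′)) ≡
                (a - a′) + (b - b′) - ((c - c′) - (d - d′))
      regroup = solve-∀

    B-recurrence : ∀ σ β L n →
      Bc σ β (suc L) n ≡ Bc σ (β + + 1) L n + Bc σ (β - + 1) L n - Δ L (Bc σ β (L ℕ.∸ 1)) n
    B-recurrence σ β L n = hasSum-unique (hasSum-Bc σ β (suc L) n)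
      (hasSum-- (hasSum-+ (hasSum-Bc σ (β + + 1) L n) (hasSum-Bc σ (β - + 1) L n))
                (hasSum-ΔBc σ β L (L ℕ.∸ 1) n))
      (λ j → term-recurrence σ β L j n)

    piece-edge-lower : ∀ τ e L j m → 0 ℕ.< L →
      piece τ (+ 1) e (L ℕ.∸ 1) j m ≡ gauss (L ℕ.∸ 1) (half (+ L + + 0 + τ) + j * K) (m - e)
    piece-edge-lower τ e (suc L) j m _ = cong (λ x → gauss L (half x + j * K) (m - e))
      (trans (reassoc (+ L) τ) (cong (λ l → l + + 0 + τ) (sym (ℤP.pos-+ 1 L))))
      where
      reassoc : ∀ l τ → l + + 1 + τ ≡ + 1 + l + + 0 + τ
      reassoc = solve-∀

    piece-edge : ∀ τ e L j n → let k = half (+ L + + 0 + τ) + j * K in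
      piece τ (+ 0) e L j n - Δ L (piece τ (+ 1) e (L ℕ.∸ 1) j) n ≡ gauss L k (n - e - (+ L - k))
    piece-edge τ e L j n = begin
      gauss L k (n - e) - Δ L (piece τ (+ 1) e (L ℕ.∸ 1) j) n
        ≡⟨ cong (λ z → gauss L k (n - e) - z)
                (trans (Δ-cong L (λ 0<L m → piece-edge-lower τ e L j m 0<L) n) (Δ-shift L (gauss (L ℕ.∸ 1) k) e n)) ⟩
      gauss L k (n - e) - Δ L (gauss (L ℕ.∸ 1) k) (n - e)
        ≡⟨ gauss-Δ L k (n - e) ⟩
      gauss L k (n - e - (+ L - k)) ∎
      where
      k : ℤ
      k = half (+ L + + 0 + τ) + j * K

    module Edge (σ a : ℤ) (L : ℕ) (n : ℤ) (L≡ : + L ≡ + 2 * a + σ) where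

      Y : ℤ → ℤ
      Y j = gauss L (a + σ + j * K) (n - expB σ j - (+ L - (a + σ + j * K)))

      private
        halfA : half (+ L + + 0 + - σ) ≡ a
        halfA = half-even (trans (cong (λ l → l + + 0 - σ) L≡) (numerator a σ))
          where
          numerator : ∀ a σ → + 2 * a + σ + + 0 - σ ≡ + 2 * a
          numerator = solve-∀

        halfB : half (+ L + + 0 + σ) ≡ a + σ
        halfB = half-even (trans (cong (λ l → l + + 0 + σ) L≡) (numerator a σ))
          where
          numerator : ∀ a σ → + 2 * a + σ + + 0 + σ ≡ + 2 * (a + σ)
          numerator = solve-∀

        Y-reflected : ∀ j → gauss L (a + j * K) (n - expA σ j - (+ L - (a + j * K))) ≡ Y (- j)
        Y-reflected j = trans (gauss-symmetric L (a + j * K) _) (gauss-cong L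
          (trans (cong (λ l → l - (a + j * K)) L≡) (index a σ j K))
          (trans (cong (λ l → n - expA σ j - (l - (a + j * K))) L≡)
                 (trans (exponent n a σ j K) (cong (λ l → n - expB σ (- j) - (l - (a + σ + - j * K))) (sym L≡)))))
          where
          index : ∀ a σ j K → + 2 * a + σ - (a + j * K) ≡ a + σ + - j * K
          index = solve-∀
          exponent : ∀ n a σ j K →
            n - j * ((+ 2 * j + + 1) * K - + 2 * σ) - (+ 2 * a + σ - (a + j * K)) ≡
            n - (+ 2 * - j + + 1) * (K * - j + σ) - (+ 2 * a + σ - (a + σ + - j * K))
          exponent = solve-∀

      -- gauss-Δ turns both terms into shifted Gaussian coefficients, and [L, k] = [L, L - k]
      -- identifies the first one with the second one at -j
      term-antisymmetric : ∀ j → term σ (+ 0) L j n - Δ L (term σ (+ 1) (L ℕ.∸ 1) j) n ≡ Y (- j) - Y j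
      term-antisymmetric j = begin
        term σ (+ 0) L j n - Δ L (term σ (+ 1) (L ℕ.∸ 1) j) n
          ≡⟨ regroup (termA σ (+ 0) L j n) (termB σ (+ 0) L j n)
                     (termA σ (+ 1) (L ℕ.∸ 1) j n) (termB σ (+ 1) (L ℕ.∸ 1) j n)
                     (termA σ (+ 1) (L ℕ.∸ 1) j (n - + L)) (termB σ (+ 1) (L ℕ.∸ 1) j (n - + L)) ⟩
        (termA σ (+ 0) L j n - Δ L (termA σ (+ 1) (L ℕ.∸ 1) j) n)
          - (termB σ (+ 0) L j n - Δ L (termB σ (+ 1) (L ℕ.∸ 1) j) n)
          ≡⟨ cong₂ _-_ (piece-edge (- σ) (expA σ j) L j n) (piece-edge σ (expB σ j) L j n) ⟩
        gauss L kA (n - expA σ j - (+ L - kA)) - gauss L kB (n - expB σ j - (+ L - kB))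
          ≡⟨ cong₂ _-_ (trans (cong (λ k → gauss L k (n - expA σ j - (+ L - k))) (cong (_+ j * K) halfA))
                              (Y-reflected j))
                       (cong (λ k → gauss L k (n - expB σ j - (+ L - k))) (cong (_+ j * K) halfB)) ⟩
        Y (- j) - Y j ∎
        where
        kA : ℤ
        kA = half (+ L + + 0 + - σ) + j * K
        kB : ℤ
        kB = half (+ L + + 0 + σ) + j * K
        regroup : ∀ a b c d c′ d′ → (a - b) - ((c - d) - (c′ - d′)) ≡ (a - (c - c′)) - (b - (d - d′))
        regroup = solve-∀

    B-edge : ∀ σ L n → Even (+ L - σ) → Bc σ (+ 0) L n - Δ L (Bc σ (+ 1) (L ℕ.∸ 1)) n ≡ + 0
    B-edge σ L n (a , L-σ≡) = hasSum-antisymmetric Y (hasSum-cong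
      (hasSum-- (hasSum-Bc σ (+ 0) L n) (hasSum-ΔBc σ (+ 1) L (L ℕ.∸ 1) n)) term-antisymmetric)
      where
      restore : ∀ l σ → l ≡ l - σ + σ
      restore = solve-∀
      open Edge σ a L n (trans (restore (+ L) σ) (cong (_+ σ) L-σ≡))

    K≡ : K ≡ + 2 * + ν + + 3
    K≡ = trans (ℤP.pos-+ (2 ℕ.* ν) 3) (cong (_+ + 3) (ℤP.pos-* 2 ν))

    module Reflection (σ a : ℤ) (L : ℕ) (n : ℤ) (even : + L + + (ν ℕ.+ 2) - σ ≡ + 2 * a) where

      σ′ : ℤ
      σ′ = K - σ

      private
        v : ℤ
        v = + ν

        L≡ : + L ≡ + 2 * a - (v + + 2) + σ
        L≡ = trans (restore (+ L) (+ (ν ℕ.+ 2)) σ)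
                   (trans (cong (λ z → z - + (ν ℕ.+ 2) + σ) even) (cong (λ p → + 2 * a - p + σ) (ℤP.pos-+ ν 2)))
          where
          restore : ∀ l p σ → l ≡ l + p - σ - p + σ
          restore = solve-∀

        halfA : half (+ L + + (ν ℕ.+ 2) - σ) ≡ a
        halfA = half-even even

        halfA′ : half (+ L + + (ν ℕ.+ 1) - σ′) ≡ a - v - + 2 + σ
        halfA′ = half-even (trans (cong (λ l → l + + (ν ℕ.+ 1) - σ′) L≡)
          (trans (cong₂ (λ p k → + 2 * a - (v + + 2) + σ + p - (k - σ)) (ℤP.pos-+ ν 1) K≡) (numerator a v σ)))
          where
          numerator : ∀ a v σ → + 2 * a - (v + + 2) + σ + (v + + 1) - (+ 2 * v + + 3 - σ) ≡ + 2 * (a - v - + 2 + σ)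
          numerator = solve-∀

        halfB : half (+ L + + (ν ℕ.+ 2) + σ) ≡ a + σ
        halfB = half-even (trans (add-2σ (+ L + + (ν ℕ.+ 2)) σ) (trans (cong (_+ + 2 * σ) even) (numerator a σ)))
          where
          add-2σ : ∀ x σ → x + σ ≡ x - σ + + 2 * σ
          add-2σ = solve-∀
          numerator : ∀ a σ → + 2 * a + + 2 * σ ≡ + 2 * (a + σ)
          numerator = solve-∀

        halfB′ : half (+ L + + (ν ℕ.+ 1) + σ′) ≡ a + v + + 1
        halfB′ = half-even (trans (cong (λ l → l + + (ν ℕ.+ 1) + σ′) L≡)
          (trans (cong₂ (λ p k → + 2 * a - (v + + 2) + σ + p + (k - σ)) (ℤP.pos-+ ν 1) K≡) (numerator a v σ)))
          where
          numerator : ∀ a v σ → + 2 * a - (v + + 2) + σ + (v + + 1) + (+ 2 * v + + 3 - σ) ≡ + 2 * (a + v + + 1)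
          numerator = solve-∀

      termA-reflect : ∀ j → termA σ (+ (ν ℕ.+ 2)) L j n ≡ termA σ′ (+ (ν ℕ.+ 1)) L (- j) n
      termA-reflect j = begin
        gauss L (half (+ L + + (ν ℕ.+ 2) - σ) + j * K) (n - expA σ j)
          ≡⟨ gauss-cong L (cong (_+ j * K) halfA) refl ⟩
        gauss L (a + j * K) (n - expA σ j)
          ≡⟨ gauss-symmetric L (a + j * K) _ ⟩
        gauss L (+ L - (a + j * K)) (n - expA σ j)
          ≡⟨ gauss-cong L (trans (cong (λ l → l - (a + j * K)) L≡)
                                 (trans (index a v σ j K) (cong (_+ - j * K) (sym halfA′))))
                          (cong (λ e → n - e) (exponent σ j K)) ⟩
        gauss L (half (+ L + + (ν ℕ.+ 1) - σ′) + - j * K) (n - expA σ′ (- j)) ∎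
        where
        index : ∀ a v σ j K → + 2 * a - (v + + 2) + σ - (a + j * K) ≡ a - v - + 2 + σ + - j * K
        index = solve-∀
        exponent : ∀ σ j K → j * ((+ 2 * j + + 1) * K - + 2 * σ) ≡ - j * ((+ 2 * - j + + 1) * K - + 2 * (K - σ))
        exponent = solve-∀

      termB-reflect : ∀ j → termB σ (+ (ν ℕ.+ 2)) L j n ≡ termB σ′ (+ (ν ℕ.+ 1)) L (- j - + 1) n
      termB-reflect j = begin
        gauss L (half (+ L + + (ν ℕ.+ 2) + σ) + j * K) (n - expB σ j)
          ≡⟨ gauss-cong L (cong (_+ j * K) halfB) refl ⟩
        gauss L (a + σ + j * K) (n - expB σ j)
          ≡⟨ gauss-symmetric L (a + σ + j * K) _ ⟩
        gauss L (+ L - (a + σ + j * K)) (n - expB σ j)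
          ≡⟨ gauss-cong L (trans (cong₂ (λ l k → l - (a + σ + j * k)) L≡ K≡)
                                 (trans (index a v σ j) (cong₂ (λ h k → h + (- j - + 1) * k) (sym halfB′) (sym K≡))))
                          (cong (λ e → n - e) (exponent σ j K)) ⟩
        gauss L (half (+ L + + (ν ℕ.+ 1) + σ′) + (- j - + 1) * K) (n - expB σ′ (- j - + 1)) ∎
        where
        index : ∀ a v σ j → + 2 * a - (v + + 2) + σ - (a + σ + j * (+ 2 * v + + 3)) ≡
                            a + v + + 1 + (- j - + 1) * (+ 2 * v + + 3)
        index = solve-∀
        exponent : ∀ σ j K → (+ 2 * j + + 1) * (K * j + σ) ≡
                             (+ 2 * (- j - + 1) + + 1) * (K * (- j - + 1) + (K - σ))
        exponent = solve-∀

    -- j ↦ -j in the first term and j ↦ -1-j in the second, together with [L, k] = [L, L - k]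
    B-reflection : ∀ σ L n → Even (+ L + + (ν ℕ.+ 2) - σ) →
                   Bc σ (+ (ν ℕ.+ 2)) L n ≡ Bc (K - σ) (+ (ν ℕ.+ 1)) L n
    B-reflection σ L n (a , even) = hasSum-unique (hasSum-Bc σ (+ (ν ℕ.+ 2)) L n)
      (subst (HasSum _) (sym (coeff-Bfun σ′ (+ (ν ℕ.+ 1)) L n))
             (hasSum-- (hasSum-∘-neg (hasSum-termA σ′ (+ (ν ℕ.+ 1)) L n))
                       (hasSum-∘-mirror (hasSum-termB σ′ (+ (ν ℕ.+ 1)) L n))))
      (λ j → cong₂ _-_ (termA-reflect j) (termB-reflect j))
      where
      open Reflection σ a L n even

    index-nonzero : ∀ {h j} → ∣ h ∣ ℕ.< K′ → j ≢ + 0 → h + j * K ≢ + 0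
    index-nonzero {h} {j} ∣h∣<K j≢0 eq = j≢0 (ℤP.∣i∣≡0⇒i≡0 (∣j∣≡0 ∣ j ∣ ∣j∣K≡∣h∣))
      where
      jK≡-h : j * K ≡ - h
      jK≡-h = trans (restore h (j * K)) (trans (cong (_- h) eq) (ℤP.+-identityˡ (- h)))
        where
        restore : ∀ h u → u ≡ h + u - h
        restore = solve-∀
      ∣j∣K≡∣h∣ : ∣ j ∣ ℕ.* K′ ≡ ∣ h ∣
      ∣j∣K≡∣h∣ = trans (sym (ℤP.abs-* j K)) (trans (cong ∣_∣ jK≡-h) (ℤP.∣-i∣≡∣i∣ h))
      ∣j∣≡0 : ∀ m → m ℕ.* K′ ≡ ∣ h ∣ → m ≡ 0
      ∣j∣≡0 zero    _  = refl
      ∣j∣≡0 (suc m) eq′ = ⊥-elim (ℕP.<-irrefl refl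
        (ℕP.<-≤-trans ∣h∣<K (ℕP.≤-trans (ℕP.m≤m+n K′ (m ℕ.* K′)) (ℕP.≤-reflexive eq′))))

    half-small : ∀ {x} → Even x → ∣ x ∣ ℕ.< 2 ℕ.* K′ → ∣ half x ∣ ℕ.< K′
    half-small {x} (w , x≡) ∣x∣< = subst (ℕ._< K′) (cong ∣_∣ (sym (half-even x≡)))
      (ℕP.*-cancelˡ-< 2 ∣ w ∣ K′ (subst (ℕ._< 2 ℕ.* K′) (trans (cong ∣_∣ x≡) (ℤP.abs-* (+ 2) w)) ∣x∣<))

    piece-0-off-centre : ∀ τ β e j n → Even (+ 0 + β + τ) → ∣ + 0 + β + τ ∣ ℕ.< 2 ℕ.* K′ → j ≢ + 0 →
                         piece τ β e 0 j n ≡ + 0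
    piece-0-off-centre τ β e j n even small j≢0 =
      gauss-0-nonzero (n - e) (index-nonzero {half (+ 0 + β + τ)} (half-small even small) j≢0)

    -- at L = 0 only the j = 0 summand survives
    B-initial : ∀ σ β n → Even (β - σ) → ∣ β ∣ ℕ.+ ∣ σ ∣ ℕ.< 2 ℕ.* K′ → β + σ ≢ + 0 →
                Bc σ β 0 n ≡ gauss 0 (half (β - σ)) n
    B-initial σ β n (w , β-σ≡) bound β+σ≢0 = begin
      Bc σ β 0 n
        ≡⟨ hasSum-unique (hasSum-Bc σ β 0 n) (hasSum-single (λ j → term σ β 0 j n) off-centre) (λ _ → refl) ⟩
      termA σ β 0 (+ 0) n - termB σ β 0 (+ 0) n
        ≡⟨ cong₂ _-_ (gauss-cong 0 (trans (ℤP.+-identityʳ _) (cong half xA≡)) (ℤP.+-identityʳ n))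
                     (gauss-0-nonzero _ centre-B≢0) ⟩
      gauss 0 (half (β - σ)) n - + 0
        ≡⟨ ℤP.+-identityʳ _ ⟩
      gauss 0 (half (β - σ)) n ∎
      where
      xA : ℤ
      xA = + 0 + β - σ
      xB : ℤ
      xB = + 0 + β + σ
      xA≡ : xA ≡ β - σ
      xA≡ = cong (_- σ) (ℤP.+-identityˡ β)
      evenA : Even xA
      evenA = w , trans xA≡ β-σ≡
      evenB : Even xB
      evenB = subst Even (sym (add-2σ (+ 0 + β) σ)) (even-+2* σ evenA)
        where
        add-2σ : ∀ x σ → x + σ ≡ x - σ + + 2 * σ
        add-2σ = solve-∀
      ∣xA∣< : ∣ xA ∣ ℕ.< 2 ℕ.* K′
      ∣xA∣< = ℕP.≤-<-trans (subst (λ y → ∣ y ∣ ℕ.≤ ∣ β ∣ ℕ.+ ∣ σ ∣) (sym xA≡) (ℤP.∣i-j∣≤∣i∣+∣j∣ β σ)) bound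
      ∣xB∣< : ∣ xB ∣ ℕ.< 2 ℕ.* K′
      ∣xB∣< = ℕP.≤-<-trans (subst (λ y → ∣ y + σ ∣ ℕ.≤ ∣ β ∣ ℕ.+ ∣ σ ∣) (sym (ℤP.+-identityˡ β))
                                   (ℤP.∣i+j∣≤∣i∣+∣j∣ β σ)) bound
      off-centre : ∀ j → j ≢ + 0 → term σ β 0 j n ≡ + 0
      off-centre j j≢0 = cong₂ _-_ (piece-0-off-centre (- σ) β (expA σ j) j n evenA ∣xA∣< j≢0)
                                   (piece-0-off-centre σ β (expB σ j) j n evenB ∣xB∣< j≢0)
      centre-B≢0 : half xB + + 0 * K ≢ + 0
      centre-B≢0 eq = β+σ≢0 (begin
        β + σ               ≡⟨ cong (_+ σ) (sym (ℤP.+-identityˡ β)) ⟩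
        xB                  ≡⟨ proj₂ evenB ⟩
        + 2 * proj₁ evenB   ≡⟨ cong (+ 2 *_) (sym (half-even (proj₂ evenB))) ⟩
        + 2 * half xB       ≡⟨ cong (+ 2 *_) (trans (sym (ℤP.+-identityʳ (half xB))) eq) ⟩
        + 0                 ∎)

  -- Paths, grown at the end

  sumSteps : (Step → ℤ) → ℤ
  sumSteps = sumList (ne ∷ se ∷ hz ∷ [])

  sumList-allSeqs-∷ : ∀ n (f : List Step → ℤ) →
    sumList (allSeqs (suc n)) f ≡ sumList (allSeqs n) (λ p → sumSteps (λ c → f (c ∷ p)))
  sumList-allSeqs-∷ n f = sumList-concatMap (λ p → (ne ∷ p) ∷ (se ∷ p) ∷ (hz ∷ p) ∷ []) (allSeqs n) f

  sumList-allSeqs-∷ʳ : ∀ n (f : List Step → ℤ) →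
    sumList (allSeqs (suc n)) f ≡ sumList (allSeqs n) (λ p → sumSteps (λ c → f (p ++ c ∷ [])))
  sumList-allSeqs-∷ʳ zero    f = sumList-allSeqs-∷ zero f
  sumList-allSeqs-∷ʳ (suc n) f = begin
    sumList (allSeqs (suc (suc n))) f
      ≡⟨ sumList-allSeqs-∷ (suc n) f ⟩
    sumList (allSeqs (suc n)) (λ q → sumSteps (λ c → f (c ∷ q)))
      ≡⟨ sumList-allSeqs-∷ʳ n (λ q → sumSteps (λ c → f (c ∷ q))) ⟩
    sumList (allSeqs n) (λ p → sumSteps (λ d → sumSteps (λ c → f (c ∷ p ++ d ∷ []))))
      ≡⟨ sumList-cong (allSeqs n) (λ p → sumList-comm (ne ∷ se ∷ hz ∷ []) (ne ∷ se ∷ hz ∷ [])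
                                                     (λ d c → f (c ∷ p ++ d ∷ []))) ⟩
    sumList (allSeqs n) (λ p → sumSteps (λ c → sumSteps (λ d → f (c ∷ p ++ d ∷ []))))
      ≡⟨ sym (sumList-allSeqs-∷ n (λ q → sumSteps (λ d → f (q ++ d ∷ [])))) ⟩
    sumList (allSeqs (suc n)) (λ q → sumSteps (λ d → f (q ++ d ∷ []))) ∎

  sumList-allSeqs-length : ∀ n (f : ℕ → List Step → ℤ) →
    sumList (allSeqs n) (λ p → f (List.length p) p) ≡ sumList (allSeqs n) (f n)
  sumList-allSeqs-length zero    f = refl
  sumList-allSeqs-length (suc n) f = begin
    sumList (allSeqs (suc n)) (λ p → f (List.length p) p)
      ≡⟨ sumList-allSeqs-∷ n (λ p → f (List.length p) p) ⟩
    sumList (allSeqs n) (λ p → sumSteps (λ c → f (suc (List.length p)) (c ∷ p)))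
      ≡⟨ sumList-allSeqs-length n (λ ℓ p → sumSteps (λ c → f (suc ℓ) (c ∷ p))) ⟩
    sumList (allSeqs n) (λ p → sumSteps (λ c → f (suc n) (c ∷ p)))
      ≡⟨ sym (sumList-allSeqs-∷ n (f (suc n))) ⟩
    sumList (allSeqs (suc n)) (f (suc n)) ∎

  isNE : Step → Bool
  isNE ne = true
  isNE se = false
  isNE hz = false

  lastNE : List Step → Bool
  lastNE []          = false
  lastNE (c ∷ [])    = isNE c
  lastNE (_ ∷ c ∷ p) = lastNE (c ∷ p)

  lastNE-∷ʳ : ∀ p c → lastNE (p ++ c ∷ []) ≡ isNE c
  lastNE-∷ʳ []          c = refl
  lastNE-∷ʳ (_ ∷ [])    c = refl
  lastNE-∷ʳ (_ ∷ d ∷ p) c = lastNE-∷ʳ (d ∷ p) c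

  heightAfter : ℕ → Step → ℕ
  heightAfter h ne = suc h
  heightAfter h se = h ℕ.∸ 1
  heightAfter h hz = h

  -- the height reached from h, disregarding whether the steps are allowed
  height : ℕ → List Step → ℕ
  height h []      = h
  height h (c ∷ p) = height (heightAfter h c) p

  endpoint⇒height : ∀ h p {e} → endpoint h p ≡ just e → height h p ≡ e
  endpoint⇒height h       []       refl = refl
  endpoint⇒height h       (ne ∷ p) eq   = endpoint⇒height (suc h) p eq
  endpoint⇒height (suc h) (se ∷ p) eq   = endpoint⇒height h p eq
  endpoint⇒height zero    (hz ∷ p) eq   = endpoint⇒height zero p eq

  stepFrom : Maybe ℕ → Step → Maybe ℕ
  stepFrom nothing  c = nothing
  stepFrom (just h) c = endpoint h (c ∷ [])

  endpoint-∷ʳ : ∀ h p c → endpoint h (p ++ c ∷ []) ≡ stepFrom (endpoint h p) c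
  endpoint-∷ʳ h       []       c = refl
  endpoint-∷ʳ h       (ne ∷ p) c = endpoint-∷ʳ (suc h) p c
  endpoint-∷ʳ zero    (se ∷ p) c = refl
  endpoint-∷ʳ (suc h) (se ∷ p) c = endpoint-∷ʳ h p c
  endpoint-∷ʳ zero    (hz ∷ p) c = endpoint-∷ʳ zero p c
  endpoint-∷ʳ (suc h) (hz ∷ p) c = refl

  newPeak : Bool → ℤ → ℕ → List (ℤ × ℕ)
  newPeak true  x h = (x , h) ∷ []
  newPeak false x h = []

  addedPeaks : ℤ → ℕ → List Step → Step → List (ℤ × ℕ)
  addedPeaks x h p se = newPeak (lastNE p) (x + + List.length p) (height h p)
  addedPeaks x h p ne = []
  addedPeaks x h p hz = []

  addedPeaks-∷ : ∀ x h a d p c →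
    addedPeaks x h (a ∷ d ∷ p) c ≡ addedPeaks (x + + 1) (heightAfter h a) (d ∷ p) c
  addedPeaks-∷ x h a d p se = cong (λ y → newPeak (lastNE (d ∷ p)) y (height h (a ∷ d ∷ p)))
    (trans (cong (λ z → x + z) (ℤP.pos-+ 1 (suc (List.length p)))) (sym (ℤP.+-assoc x (+ 1) _)))
  addedPeaks-∷ x h a d p ne = refl
  addedPeaks-∷ x h a d p hz = refl

  peaks-∷ʳ : ∀ x h p c → peaks x h (p ++ c ∷ []) ≡ peaks x h p ++ addedPeaks x h p c
  peaks-∷ʳ x h []            ne = refl
  peaks-∷ʳ x h []            se = refl
  peaks-∷ʳ x h []            hz = refl
  peaks-∷ʳ x h (ne ∷ [])     ne = refl
  peaks-∷ʳ x h (ne ∷ [])     se = refl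
  peaks-∷ʳ x h (ne ∷ [])     hz = refl
  peaks-∷ʳ x h (se ∷ [])     ne = refl
  peaks-∷ʳ x h (se ∷ [])     se = refl
  peaks-∷ʳ x h (se ∷ [])     hz = refl
  peaks-∷ʳ x h (hz ∷ [])     ne = refl
  peaks-∷ʳ x h (hz ∷ [])     se = refl
  peaks-∷ʳ x h (hz ∷ [])     hz = refl
  peaks-∷ʳ x h (ne ∷ se ∷ p) c = cong ((x + + 1 , suc h) ∷_)
    (trans (peaks-∷ʳ _ _ (se ∷ p) c) (cong (_ ++_) (sym (addedPeaks-∷ x h ne se p c))))
  peaks-∷ʳ x h (ne ∷ ne ∷ p) c = trans (peaks-∷ʳ _ _ (ne ∷ p) c) (cong (_ ++_) (sym (addedPeaks-∷ x h ne ne p c)))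
  peaks-∷ʳ x h (ne ∷ hz ∷ p) c = trans (peaks-∷ʳ _ _ (hz ∷ p) c) (cong (_ ++_) (sym (addedPeaks-∷ x h ne hz p c)))
  peaks-∷ʳ x h (se ∷ d ∷ p)  c = trans (peaks-∷ʳ _ _ (d ∷ p) c) (cong (_ ++_) (sym (addedPeaks-∷ x h se d p c)))
  peaks-∷ʳ x h (hz ∷ d ∷ p)  c = trans (peaks-∷ʳ _ _ (d ∷ p) c) (cong (_ ++_) (sym (addedPeaks-∷ x h hz d p c)))

  weight-++ : ∀ ps qs → weight (ps ++ qs) ≡ weight ps + weight qs
  weight-++ []             qs = sym (ℤP.+-identityˡ _)
  weight-++ ((x , h) ∷ ps) qs = trans (cong (λ z → x + z) (weight-++ ps qs)) (sym (ℤP.+-assoc x _ _))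

  allLow-++ : ∀ ν ps qs → allLow ν (ps ++ qs) ≡ allLow ν ps ∧ allLow ν qs
  allLow-++ ν []             qs = refl
  allLow-++ ν ((x , h) ∷ ps) qs = trans (cong ((h ℕ.≤ᵇ ν) ∧_) (allLow-++ ν ps qs))
                                        (sym (BoolP.∧-assoc (h ℕ.≤ᵇ ν) (allLow ν ps) (allLow ν qs)))

  when : Bool → ℤ → ℤ
  when t x = if t then x else + 0

  when-zero : ∀ t → when t (+ 0) ≡ + 0
  when-zero true  = refl
  when-zero false = refl

  when-split : ∀ t x → x ≡ when t x + when (not t) x
  when-split true  x = sym (ℤP.+-identityʳ x)
  when-split false x = sym (ℤP.+-identityˡ x)

  when-true : ∀ {t} x → T t → when t x ≡ x
  when-true {true} x _ = refl

  when-false : ∀ {t} x → ¬ T t → when t x ≡ + 0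
  when-false {false} x _  = refl
  when-false {true}  x ¬t = ⊥-elim (¬t _)

  sumList-when : {A : Set} (xs : List A) (t : Bool) (f : A → ℤ) →
                 sumList xs (λ x → when t (f x)) ≡ when t (sumList xs f)
  sumList-when xs true  f = refl
  sumList-when xs false f = sumList-zero xs

  sumList-filterᵇ : {A : Set} (P : A → Bool) (xs : List A) (f : A → ℤ) →
                    sumList (List.filterᵇ P xs) f ≡ sumList xs (λ x → when (P x) (f x))
  sumList-filterᵇ P []       f = refl
  sumList-filterᵇ P (x ∷ xs) f with P x
  ... | true  = cong (λ z → f x + z) (sumList-filterᵇ P xs f)
  ... | false = trans (sumList-filterᵇ P xs f) (sym (ℤP.+-identityˡ _))

  coeff-monomial-+ : ∀ w x m → coeff (monomial (w + x)) m ≡ coeff (monomial w) (m - x)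
  coeff-monomial-+ w x m = trans (cong (λ e → coeff (monomial e) m) (ℤP.+-comm w x))
                                 (coeff-shift x (monomial w) m)

  -- The path sums C

  module PathSum (ν s : ℕ) where

    pathTerm : Maybe ℕ → List (ℤ × ℕ) → ℕ → ℤ → ℤ
    pathTerm E P b m = when (eqMaybe E b ∧ allLow ν P) (coeff (monomial (weight P)) m)

    contrib : ℕ → ℤ → List Step → ℤ
    contrib b m p = pathTerm (endpoint s p) (peaks (+ 0) s p) b m

    C : ℕ → ℕ → ℤ → ℤ
    C n b m = coeff (Cfun ν (+ 0) n s b) m

    C↑ C↓ : ℕ → ℕ → ℤ → ℤ
    C↑ n b m = sumList (allSeqs n) (λ p → when (lastNE p) (contrib b m p))
    C↓ n b m = sumList (allSeqs n) (λ p → when (not (lastNE p)) (contrib b m p))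

    C≡sum : ∀ n b m → C n b m ≡ sumList (allSeqs n) (contrib b m)
    C≡sum n b m = trans (coeff-foldr-⊕ (λ p → monomial (weight (peaks (+ 0) s p))) (List.filterᵇ ok (allSeqs n)) m)
                        (sumList-filterᵇ ok (allSeqs n) (λ p → coeff (monomial (weight (peaks (+ 0) s p))) m))
      where
      ok : List Step → Bool
      ok p = eqMaybe (endpoint s p) b ∧ allLow ν (peaks (+ 0) s p)

    C-split : ∀ n b m → C n b m ≡ C↑ n b m + C↓ n b m
    C-split n b m = trans (C≡sum n b m)
      (trans (sumList-cong (allSeqs n) (λ p → when-split (lastNE p) (contrib b m p)))
             (sumList-+ (allSeqs n) (λ p → when (lastNE p) (contrib b m p))
                                    (λ p → when (not (lastNE p)) (contrib b m p))))

    C-initial : ∀ b m → C 0 b m ≡ when (s ℕ.≡ᵇ b) (coeff oneP m)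
    C-initial b m with s ℕ.≡ᵇ b
    ... | true  = refl
    ... | false = refl

    contrib-∷ʳ : ∀ b m p c →
      contrib b m (p ++ c ∷ []) ≡ pathTerm (stepFrom (endpoint s p) c) (peaks (+ 0) s p ++ addedPeaks (+ 0) s p c) b m
    contrib-∷ʳ b m p c = cong₂ (λ E P → pathTerm E P b m) (endpoint-∷ʳ s p c) (peaks-∷ʳ (+ 0) s p c)

    sumSteps-up : ∀ p (g : List Step → ℤ) →
      sumSteps (λ c → when (lastNE (p ++ c ∷ [])) (g (p ++ c ∷ []))) ≡ g (p ++ ne ∷ [])
    sumSteps-up p g rewrite lastNE-∷ʳ p ne | lastNE-∷ʳ p se | lastNE-∷ʳ p hz = ℤP.+-identityʳ _

    sumSteps-down : ∀ p (g : List Step → ℤ) →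
      sumSteps (λ c → when (not (lastNE (p ++ c ∷ []))) (g (p ++ c ∷ []))) ≡ g (p ++ se ∷ []) + g (p ++ hz ∷ [])
    sumSteps-down p g rewrite lastNE-∷ʳ p ne | lastNE-∷ʳ p se | lastNE-∷ʳ p hz =
      trans (ℤP.+-identityˡ _) (cong (λ z → g (p ++ se ∷ []) + z) (ℤP.+-identityʳ _))

    pathTerm-ne : ∀ E P b m → pathTerm (stepFrom E ne) (P ++ []) (suc b) m ≡ pathTerm E P b m
    pathTerm-ne nothing  P b m = refl
    pathTerm-ne (just e) P b m rewrite ListP.++-identityʳ P = refl

    pathTerm-ne-zero : ∀ E P m → pathTerm (stepFrom E ne) P 0 m ≡ + 0
    pathTerm-ne-zero nothing  P m = refl
    pathTerm-ne-zero (just e) P m = refl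

    pathTerm-hz-zero : ∀ E P m → pathTerm (stepFrom E hz) (P ++ []) 0 m ≡ pathTerm E P 0 m
    pathTerm-hz-zero nothing        P m = refl
    pathTerm-hz-zero (just zero)    P m rewrite ListP.++-identityʳ P = refl
    pathTerm-hz-zero (just (suc e)) P m = refl

    pathTerm-hz-suc : ∀ E P b m → pathTerm (stepFrom E hz) P (suc b) m ≡ + 0
    pathTerm-hz-suc nothing        P b m = refl
    pathTerm-hz-suc (just zero)    P b m = refl
    pathTerm-hz-suc (just (suc e)) P b m = refl

    -- an SE step after an NE step creates a peak at (X , H), which must have H ≤ ν
    pathTerm-se : ∀ E P l X H b m → (∀ {e} → E ≡ just e → H ≡ e) →
      pathTerm (stepFrom E se) (P ++ newPeak l X H) b m ≡
      when (not l) (pathTerm E P (suc b) m) + when (l ∧ (suc b ℕ.≤ᵇ ν)) (pathTerm E P (suc b) (m - X))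
    pathTerm-se nothing        P l X H b m _ = sym (cong₂ _+_ (when-zero (not l)) (when-zero (l ∧ _)))
    pathTerm-se (just zero)    P l X H b m _ = sym (cong₂ _+_ (when-zero (not l)) (when-zero (l ∧ _)))
    pathTerm-se (just (suc e)) P false X H b m _ rewrite ListP.++-identityʳ P = sym (ℤP.+-identityʳ _)
    pathTerm-se (just (suc e)) P true X H b m H≡ with e ℕ.≡ᵇ b in e≡ᵇb
    ... | false = sym (trans (ℤP.+-identityˡ _) (when-zero (suc b ℕ.≤ᵇ ν)))
    ... | true rewrite allLow-++ ν P ((X , H) ∷ []) | weight-++ P ((X , H) ∷ [])
                     | H≡ refl | ℕP.≡ᵇ⇒≡ e b (subst T (sym e≡ᵇb) _) = new-peak (allLow ν P) (suc b ℕ.≤ᵇ ν)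
      where
      new-peak : ∀ low top → when (low ∧ (top ∧ true)) (coeff (monomial (weight P + (X + + 0))) m) ≡
                             + 0 + when top (when low (coeff (monomial (weight P)) (m - X)))
      new-peak true  true  = trans (cong (λ x → coeff (monomial (weight P + x)) m) (ℤP.+-identityʳ X))
                                   (trans (coeff-monomial-+ (weight P) X m) (sym (ℤP.+-identityˡ _)))
      new-peak true  false = refl
      new-peak false true  = refl
      new-peak false false = refl

    C↑-suc : ∀ n b m → C↑ (suc n) (suc b) m ≡ C n b m
    C↑-suc n b m = begin
      C↑ (suc n) (suc b) m
        ≡⟨ sumList-allSeqs-∷ʳ n (λ p → when (lastNE p) (contrib (suc b) m p)) ⟩
      sumList (allSeqs n) (λ p → sumSteps (λ c → when (lastNE (p ++ c ∷ [])) (contrib (suc b) m (p ++ c ∷ []))))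
        ≡⟨ sumList-cong (allSeqs n) (λ p → trans (sumSteps-up p (contrib (suc b) m))
             (trans (contrib-∷ʳ (suc b) m p ne) (pathTerm-ne (endpoint s p) (peaks (+ 0) s p) b m))) ⟩
      sumList (allSeqs n) (contrib b m)
        ≡⟨ sym (C≡sum n b m) ⟩
      C n b m ∎

    C↑-suc-zero : ∀ n m → C↑ (suc n) 0 m ≡ + 0
    C↑-suc-zero n m = begin
      C↑ (suc n) 0 m
        ≡⟨ sumList-allSeqs-∷ʳ n (λ p → when (lastNE p) (contrib 0 m p)) ⟩
      sumList (allSeqs n) (λ p → sumSteps (λ c → when (lastNE (p ++ c ∷ [])) (contrib 0 m (p ++ c ∷ []))))
        ≡⟨ sumList-cong (allSeqs n) (λ p → trans (sumSteps-up p (contrib 0 m))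
             (trans (contrib-∷ʳ 0 m p ne)
                    (pathTerm-ne-zero (endpoint s p) (peaks (+ 0) s p ++ addedPeaks (+ 0) s p ne) m))) ⟩
      sumList (allSeqs n) (λ _ → + 0)
        ≡⟨ sumList-zero (allSeqs n) ⟩
      + 0 ∎

    C∷ʳ : Step → ℕ → ℕ → ℤ → ℤ
    C∷ʳ c n b m = sumList (allSeqs n) (λ p → contrib b m (p ++ c ∷ []))

    C↓-suc : ∀ n b m → C↓ (suc n) b m ≡ C∷ʳ se n b m + C∷ʳ hz n b m
    C↓-suc n b m = begin
      C↓ (suc n) b m
        ≡⟨ sumList-allSeqs-∷ʳ n (λ p → when (not (lastNE p)) (contrib b m p)) ⟩
      sumList (allSeqs n) (λ p → sumSteps (λ c → when (not (lastNE (p ++ c ∷ []))) (contrib b m (p ++ c ∷ []))))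
        ≡⟨ sumList-cong (allSeqs n) (λ p → sumSteps-down p (contrib b m)) ⟩
      sumList (allSeqs n) (λ p → contrib b m (p ++ se ∷ []) + contrib b m (p ++ hz ∷ []))
        ≡⟨ sumList-+ (allSeqs n) (λ p → contrib b m (p ++ se ∷ [])) (λ p → contrib b m (p ++ hz ∷ [])) ⟩
      C∷ʳ se n b m + C∷ʳ hz n b m ∎

    when-∧ : ∀ l t x → when (l ∧ t) x ≡ when t (when l x)
    when-∧ true  t     x = refl
    when-∧ false true  x = refl
    when-∧ false false x = refl

    -- the last peak of a path ending with NE then SE sits at x = n
    C∷ʳ-se : ∀ n b m → C∷ʳ se n b m ≡ C↓ n (suc b) m + when (suc b ℕ.≤ᵇ ν) (C↑ n (suc b) (m - + n))
    C∷ʳ-se n b m = begin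
      C∷ʳ se n b m
        ≡⟨ sumList-cong (allSeqs n) (λ p → trans (contrib-∷ʳ b m p se)
             (pathTerm-se (endpoint s p) (peaks (+ 0) s p) (lastNE p) (x p) (height s p) b m (endpoint⇒height s p))) ⟩
      sumList (allSeqs n) (λ p → when (not (lastNE p)) (contrib (suc b) m p)
                                 + when (lastNE p ∧ t) (contrib (suc b) (m - x p) p))
        ≡⟨ sumList-+ (allSeqs n) (λ p → when (not (lastNE p)) (contrib (suc b) m p))
                                 (λ p → when (lastNE p ∧ t) (contrib (suc b) (m - x p) p)) ⟩
      C↓ n (suc b) m + sumList (allSeqs n) (λ p → when (lastNE p ∧ t) (contrib (suc b) (m - x p) p))
        ≡⟨ cong (λ z → C↓ n (suc b) m + z) (begin
             sumList (allSeqs n) (λ p → when (lastNE p ∧ t) (contrib (suc b) (m - x p) p))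
               ≡⟨ sumList-allSeqs-length n (λ ℓ p → when (lastNE p ∧ t) (contrib (suc b) (m - (+ 0 + + ℓ)) p)) ⟩
             sumList (allSeqs n) (λ p → when (lastNE p ∧ t) (contrib (suc b) (m - (+ 0 + + n)) p))
               ≡⟨ sumList-cong (allSeqs n) (λ p → trans (when-∧ (lastNE p) t _)
                    (cong (λ y → when t (when (lastNE p) (contrib (suc b) (m - y) p))) (ℤP.+-identityˡ (+ n)))) ⟩
             sumList (allSeqs n) (λ p → when t (when (lastNE p) (contrib (suc b) (m - + n) p)))
               ≡⟨ sumList-when (allSeqs n) t _ ⟩
             when t (C↑ n (suc b) (m - + n)) ∎) ⟩
      C↓ n (suc b) m + when t (C↑ n (suc b) (m - + n)) ∎
      where
      t : Bool
      t = suc b ℕ.≤ᵇ ν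
      x : List Step → ℤ
      x p = + 0 + + List.length p

    C∷ʳ-hz-zero : ∀ n m → C∷ʳ hz n 0 m ≡ C n 0 m
    C∷ʳ-hz-zero n m = trans (sumList-cong (allSeqs n) (λ p → trans (contrib-∷ʳ 0 m p hz)
                                 (pathTerm-hz-zero (endpoint s p) (peaks (+ 0) s p) m)))
                               (sym (C≡sum n 0 m))

    C∷ʳ-hz-suc : ∀ n b m → C∷ʳ hz n (suc b) m ≡ + 0
    C∷ʳ-hz-suc n b m = trans (sumList-cong (allSeqs n) (λ p → trans (contrib-∷ʳ (suc b) m p hz)
                                  (pathTerm-hz-suc (endpoint s p) (peaks (+ 0) s p ++ addedPeaks (+ 0) s p hz) b m)))
                                (sumList-zero (allSeqs n))

    Δ-C↑ : ∀ n b m → Δ n (C↑ n (suc b)) m ≡ Δ n (C (n ℕ.∸ 1) b) m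
    Δ-C↑ zero    b = Δ-cong 0 {C↑ 0 (suc b)} {C 0 b} (λ ())
    Δ-C↑ (suc n) b = Δ-cong (suc n) (λ _ m → C↑-suc n b m)

    C↓-suc-zero : ∀ n m → C↓ (suc n) 0 m ≡ C↓ n 1 m + when (1 ℕ.≤ᵇ ν) (C↑ n 1 (m - + n)) + C n 0 m
    C↓-suc-zero n m = trans (C↓-suc n 0 m) (cong₂ _+_ (C∷ʳ-se n 0 m) (C∷ʳ-hz-zero n m))

    C↓-suc-suc : ∀ n b m →
      C↓ (suc n) (suc b) m ≡ C↓ n (suc (suc b)) m + when (suc (suc b) ℕ.≤ᵇ ν) (C↑ n (suc (suc b)) (m - + n))
    C↓-suc-suc n b m = trans (C↓-suc n (suc b) m)
      (trans (cong₂ _+_ (C∷ʳ-se n (suc b) m) (C∷ʳ-hz-suc n b m)) (ℤP.+-identityʳ _))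

    C↓-high : s ℕ.≤ ν → ∀ n b m → ν ℕ.< b → C↓ n b m ≡ + 0
    C↓-high s≤ν zero b m ν<b with s ℕ.≡ᵇ b in s≡ᵇb
    ... | false = refl
    ... | true  = ⊥-elim (ℕP.<-irrefl (ℕP.≡ᵇ⇒≡ s b (subst T (sym s≡ᵇb) _)) (ℕP.≤-<-trans s≤ν ν<b))
    C↓-high s≤ν (suc n) (suc b) m ν<b = begin
      C↓ (suc n) (suc b) m
        ≡⟨ C↓-suc-suc n b m ⟩
      C↓ n (suc (suc b)) m + when (suc (suc b) ℕ.≤ᵇ ν) (C↑ n (suc (suc b)) (m - + n))
        ≡⟨ cong₂ _+_ (C↓-high s≤ν n (suc (suc b)) m (ℕP.m<n⇒m<1+n ν<b))
                     (when-false _ (λ le → ℕP.<⇒≱ ν<b (ℕP.≤-trans (ℕP.n≤1+n _) (ℕP.≤ᵇ⇒≤ _ ν le)))) ⟩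
      + 0 ∎

    C-bottom : 1 ℕ.≤ ν → ∀ n m → C (suc n) 0 m ≡ C n 0 m + C n 1 m - Δ n (C (n ℕ.∸ 1) 0) m
    C-bottom 1≤ν n m = begin
      C (suc n) 0 m
        ≡⟨ C-split (suc n) 0 m ⟩
      C↑ (suc n) 0 m + C↓ (suc n) 0 m
        ≡⟨ cong₂ _+_ (C↑-suc-zero n m) (C↓-suc-zero n m) ⟩
      + 0 + (C↓ n 1 m + when (1 ℕ.≤ᵇ ν) (C↑ n 1 (m - + n)) + C n 0 m)
        ≡⟨ cong (λ x → + 0 + (C↓ n 1 m + x + C n 0 m)) (when-true _ (ℕP.≤⇒≤ᵇ 1≤ν)) ⟩
      + 0 + (C↓ n 1 m + C↑ n 1 (m - + n) + C n 0 m)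
        ≡⟨ regroup (C↓ n 1 m) (C↑ n 1 (m - + n)) (C n 0 m) (C↑ n 1 m) ⟩
      C n 0 m + (C↑ n 1 m + C↓ n 1 m) - Δ n (C↑ n 1) m
        ≡⟨ cong₂ (λ x y → C n 0 m + x - y) (sym (C-split n 1 m)) (Δ-C↑ n 0 m) ⟩
      C n 0 m + C n 1 m - Δ n (C (n ℕ.∸ 1) 0) m ∎
      where
      regroup : ∀ d u′ c u → + 0 + (d + u′ + c) ≡ c + (u + d) - (u - u′)
      regroup = solve-∀

    C-middle : ∀ n b m → suc (suc b) ℕ.≤ ν →
      C (suc n) (suc b) m ≡ C n b m + C n (suc (suc b)) m - Δ n (C (n ℕ.∸ 1) (suc b)) m
    C-middle n b m b+2≤ν = begin
      C (suc n) (suc b) m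
        ≡⟨ C-split (suc n) (suc b) m ⟩
      C↑ (suc n) (suc b) m + C↓ (suc n) (suc b) m
        ≡⟨ cong₂ _+_ (C↑-suc n b m) (C↓-suc-suc n b m) ⟩
      C n b m + (C↓ n b₂ m + when (b₂ ℕ.≤ᵇ ν) (C↑ n b₂ (m - + n)))
        ≡⟨ cong (λ x → C n b m + (C↓ n b₂ m + x)) (when-true _ (ℕP.≤⇒≤ᵇ b+2≤ν)) ⟩
      C n b m + (C↓ n b₂ m + C↑ n b₂ (m - + n))
        ≡⟨ regroup (C n b m) (C↓ n b₂ m) (C↑ n b₂ (m - + n)) (C↑ n b₂ m) ⟩
      C n b m + (C↑ n b₂ m + C↓ n b₂ m) - Δ n (C↑ n b₂) m
        ≡⟨ cong₂ (λ x y → C n b m + x - y) (sym (C-split n b₂ m)) (Δ-C↑ n (suc b) m) ⟩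
      C n b m + C n b₂ m - Δ n (C (n ℕ.∸ 1) (suc b)) m ∎
      where
      b₂ : ℕ
      b₂ = suc (suc b)
      regroup : ∀ c d u′ u → c + (d + u′) ≡ c + (u + d) - (u - u′)
      regroup = solve-∀

    C-top : s ℕ.≤ ν → ∀ n b m → suc b ≡ ν → C (suc n) (suc b) m ≡ C n b m
    C-top s≤ν n b m b+1≡ν = begin
      C (suc n) (suc b) m
        ≡⟨ C-split (suc n) (suc b) m ⟩
      C↑ (suc n) (suc b) m + C↓ (suc n) (suc b) m
        ≡⟨ cong₂ _+_ (C↑-suc n b m) (C↓-suc-suc n b m) ⟩
      C n b m + (C↓ n b₂ m + when (b₂ ℕ.≤ᵇ ν) (C↑ n b₂ (m - + n)))
        ≡⟨ cong₂ (λ x y → C n b m + (x + y)) (C↓-high s≤ν n b₂ m ν<b₂)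
                 (when-false _ (λ le → ℕP.<⇒≱ ν<b₂ (ℕP.≤ᵇ⇒≤ _ ν le))) ⟩
      C n b m + + 0
        ≡⟨ ℤP.+-identityʳ _ ⟩
      C n b m ∎
      where
      b₂ : ℕ
      b₂ = suc (suc b)
      ν<b₂ : ν ℕ.< b₂
      ν<b₂ = ℕP.≤-reflexive (cong suc (sym b+1≡ν))

  -- The common recurrence

  module Recurrence (ν s : ℕ) where

    open BSum ν
    open PathSum ν s

    ⟦_⟧ : Bool → ℤ
    ⟦ false ⟧ = + 0
    ⟦ true  ⟧ = + 1

    -- n ≡ s + b + ⟦ c ⟧ (mod 2): c records whether L ≢ s + b, the case split of the theorem
    Admissible : ℕ → Bool → ℕ → Set
    Admissible n c b = Even (+ n - + s - + b - ⟦ c ⟧)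

    private
      +suc : ∀ n → + suc n ≡ + 1 + + n
      +suc n = ℤP.pos-+ 1 n

    admissible-up : ∀ {n c b} → Admissible (suc n) c (suc b) → Admissible n c b
    admissible-up {n} {c} {b} adm = even-shift (+ 0) adm
      (trans (cancel (+ n) (+ s) (+ b) ⟦ c ⟧)
             (cong₂ (λ x y → x - + s - y - ⟦ c ⟧ + + 2 * + 0) (sym (+suc n)) (sym (+suc b))))
      where
      cancel : ∀ n s b c → n - s - b - c ≡ + 1 + n - s - (+ 1 + b) - c + + 2 * + 0
      cancel = solve-∀

    admissible-down : ∀ {n c b} → Admissible (suc n) c b → Admissible n c (suc b)
    admissible-down {n} {c} {b} adm = even-shift (- + 1) adm
      (trans (cong (λ y → + n - + s - y - ⟦ c ⟧) (+suc b))
             (trans (rearrange (+ n) (+ s) (+ b) ⟦ c ⟧)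
                    (cong (λ x → x - + s - + b - ⟦ c ⟧ + + 2 * - + 1) (sym (+suc n)))))
      where
      rearrange : ∀ n s b c → n - s - (+ 1 + b) - c ≡ + 1 + n - s - b - c + + 2 * - + 1
      rearrange = solve-∀

    admissible-prev : ∀ {n c b} → Admissible (suc (suc n)) c b → Admissible n c b
    admissible-prev {n} {c} {b} adm = even-shift (- + 1) adm
      (trans (rearrange (+ n) (+ s) (+ b) ⟦ c ⟧)
             (cong (λ x → x - + s - + b - ⟦ c ⟧ + + 2 * - + 1) (sym (ℤP.pos-+ 2 n))))
      where
      rearrange : ∀ n s b c → n - s - b - c ≡ + 2 + n - s - b - c + + 2 * - + 1
      rearrange = solve-∀

    admissible-flip : ∀ {n c} → Admissible (suc n) c 0 → Admissible n (not c) 0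
    admissible-flip {n} {false} adm = even-shift (- + 1) adm
      (trans (rearrange (+ n) (+ s)) (cong (λ x → x - + s - + 0 - + 0 + + 2 * - + 1) (sym (+suc n))))
      where
      rearrange : ∀ n s → n - s - + 0 - + 1 ≡ + 1 + n - s - + 0 - + 0 + + 2 * - + 1
      rearrange = solve-∀
    admissible-flip {n} {true} adm = even-shift (+ 0) adm
      (trans (rearrange (+ n) (+ s)) (cong (λ x → x - + s - + 0 - + 1 + + 2 * + 0) (sym (+suc n))))
      where
      rearrange : ∀ n s → n - s - + 0 - + 0 ≡ + 1 + n - s - + 0 - + 1 + + 2 * + 0
      rearrange = solve-∀

    record Recurrent (F : ℕ → Bool → ℕ → ℤ → ℤ) : Set where
      field
        bottom : ∀ {n c} → Admissible (suc n) c 0 → ∀ m →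
                 F (suc n) c 0 m ≡ F n (not c) 0 m + F n c 1 m - Δ n (F (n ℕ.∸ 1) c 0) m
        middle : ∀ {n c b} → suc (suc b) ℕ.≤ ν → Admissible (suc n) c (suc b) → ∀ m →
                 F (suc n) c (suc b) m ≡ F n c b m + F n c (suc (suc b)) m - Δ n (F (n ℕ.∸ 1) c (suc b)) m
        top    : ∀ {n c b} → suc b ≡ ν → Admissible (suc n) c (suc b) → ∀ m →
                 F (suc n) c (suc b) m ≡ F n c b m

    module _ (1≤ν : 1 ℕ.≤ ν) {F G : ℕ → Bool → ℕ → ℤ → ℤ} (RF : Recurrent F) (RG : Recurrent G) where
      private
        module RF = Recurrent RF
        module RG = Recurrent RG

      AgreeAt : ℕ → Set
      AgreeAt n = ∀ c b → b ℕ.≤ ν → Admissible n c b → F n c b ≗ G n c b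

      private
        Δ-agree : ∀ n c b → AgreeAt (n ℕ.∸ 1) → b ℕ.≤ ν → Admissible (suc n) c b →
                  Δ n (F (n ℕ.∸ 1) c b) ≗ Δ n (G (n ℕ.∸ 1) c b)
        Δ-agree zero    c b _    _   _   = Δ-cong 0 {F 0 c b} {G 0 c b} (λ ())
        Δ-agree (suc n) c b prev b≤ν adm = Δ-cong (suc n) (λ _ → prev c b b≤ν (admissible-prev adm))

        agree-suc : ∀ n → AgreeAt n → AgreeAt (n ℕ.∸ 1) → AgreeAt (suc n)
        agree-suc n now prev c zero _ adm m = begin
          F (suc n) c 0 m                                               ≡⟨ RF.bottom adm m ⟩
          F n (not c) 0 m + F n c 1 m - Δ n (F (n ℕ.∸ 1) c 0) m
            ≡⟨ cong₂ _-_ (cong₂ _+_ (now (not c) 0 z≤n (admissible-flip adm) m)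
                                     (now c 1 1≤ν (admissible-down adm) m))
                         (Δ-agree n c 0 prev z≤n adm m) ⟩
          G n (not c) 0 m + G n c 1 m - Δ n (G (n ℕ.∸ 1) c 0) m        ≡⟨ sym (RG.bottom adm m) ⟩
          G (suc n) c 0 m                                               ∎
        agree-suc n now prev c (suc b) b+1≤ν adm m with ℕP.m≤n⇒m<n∨m≡n b+1≤ν
        ... | inj₁ b+2≤ν = begin
          F (suc n) c (suc b) m                                         ≡⟨ RF.middle b+2≤ν adm m ⟩
          F n c b m + F n c (suc (suc b)) m - Δ n (F (n ℕ.∸ 1) c (suc b)) m
            ≡⟨ cong₂ _-_ (cong₂ _+_ (now c b (ℕP.<⇒≤ b+1≤ν) (admissible-up adm) m)
                                     (now c (suc (suc b)) b+2≤ν (admissible-down adm) m))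
                         (Δ-agree n c (suc b) prev b+1≤ν adm m) ⟩
          G n c b m + G n c (suc (suc b)) m - Δ n (G (n ℕ.∸ 1) c (suc b)) m ≡⟨ sym (RG.middle b+2≤ν adm m) ⟩
          G (suc n) c (suc b) m                                         ∎
        ... | inj₂ b+1≡ν = begin
          F (suc n) c (suc b) m  ≡⟨ RF.top b+1≡ν adm m ⟩
          F n c b m              ≡⟨ now c b (ℕP.<⇒≤ b+1≤ν) (admissible-up adm) m ⟩
          G n c b m              ≡⟨ sym (RG.top b+1≡ν adm m) ⟩
          G (suc n) c (suc b) m  ∎

      recurrent-unique : AgreeAt 0 → ∀ n → AgreeAt n
      recurrent-unique initial n = proj₁ (agree n)
        where
        agree : ∀ n → AgreeAt n × AgreeAt (n ℕ.∸ 1)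
        agree zero    = initial , initial
        agree (suc n) = agree-suc n (proj₁ (agree n)) (proj₂ (agree n)) , proj₁ (agree n)

    σ : Bool → ℤ
    σ false = + (ν ℕ.+ 1) - + s
    σ true  = + (ν ℕ.+ 2 ℕ.+ s)

    β : ℕ → ℤ
    β b = + (ν ℕ.+ 1) - + b

    Bν Cν : ℕ → Bool → ℕ → ℤ → ℤ
    Bν n c b = Bc (σ c) (β b) n
    Cν n _ b = C n b

    private
      ν+1≡ : + (ν ℕ.+ 1) ≡ + ν + + 1
      ν+1≡ = ℤP.pos-+ ν 1
      ν+2+s≡ : + (ν ℕ.+ 2 ℕ.+ s) ≡ + ν + + 2 + + s
      ν+2+s≡ = trans (ℤP.pos-+ (ν ℕ.+ 2) s) (cong (_+ + s) (ℤP.pos-+ ν 2))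

    even-numerator : ∀ {n c b} → Admissible n c b → Even (+ n + β b - σ c)
    even-numerator {n} {false} {b} adm = even-shift (+ s) adm (rearrange (+ n) (+ (ν ℕ.+ 1)) (+ s) (+ b))
      where
      rearrange : ∀ n p s b → n + (p - b) - (p - s) ≡ n - s - b - + 0 + + 2 * s
      rearrange = solve-∀
    even-numerator {n} {true} {b} adm = even-shift (+ 0) adm
      (trans (cong₂ (λ p q → + n + (p - + b) - q) ν+1≡ ν+2+s≡) (rearrange (+ n) (+ ν) (+ s) (+ b)))
      where
      rearrange : ∀ n v s b → n + (v + + 1 - b) - (v + + 2 + s) ≡ n - s - b - + 1 + + 2 * + 0
      rearrange = solve-∀

    K-σ : ∀ c → K - σ c ≡ σ (not c)
    K-σ false = trans (cong₂ (λ k p → k - (p - + s)) K≡ ν+1≡) (trans (rearrange (+ ν) (+ s)) (sym ν+2+s≡))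
      where
      rearrange : ∀ v s → + 2 * v + + 3 - (v + + 1 - s) ≡ v + + 2 + s
      rearrange = solve-∀
    K-σ true = trans (cong₂ _-_ K≡ ν+2+s≡) (trans (rearrange (+ ν) (+ s)) (cong (_- + s) (sym ν+1≡)))
      where
      rearrange : ∀ v s → + 2 * v + + 3 - (v + + 2 + s) ≡ v + + 1 - s
      rearrange = solve-∀

    β-suc : ∀ b → β (suc b) + + 1 ≡ β b
    β-suc b = trans (cong (λ x → + (ν ℕ.+ 1) - x + + 1) (ℤP.pos-+ 1 b)) (cancel (+ (ν ℕ.+ 1)) (+ b))
      where
      cancel : ∀ p b → p - (+ 1 + b) + + 1 ≡ p - b
      cancel = solve-∀

    β-pred : ∀ b → β b - + 1 ≡ β (suc b)
    β-pred b = trans (reassoc (+ (ν ℕ.+ 1)) (+ b)) (cong (λ x → + (ν ℕ.+ 1) - x) (sym (ℤP.pos-+ 1 b)))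
      where
      reassoc : ∀ p b → p - b - + 1 ≡ p - (+ 1 + b)
      reassoc = solve-∀

    β-top : ∀ {b} → suc b ≡ ν → β (suc b) ≡ + 1 × β b ≡ + 2
    β-top {b} refl = trans (cong (λ x → x - + suc b) (ℤP.pos-+ (suc b) 1)) (cancel₁ (+ suc b))
                   , trans (cong (_- + b) (trans (ℤP.pos-+ (suc b) 1) (cong (_+ + 1) (ℤP.pos-+ 1 b))))
                           (cancel₂ (+ b))
      where
      cancel₁ : ∀ x → x + + 1 - x ≡ + 1
      cancel₁ = solve-∀
      cancel₂ : ∀ x → + 1 + x + + 1 - x ≡ + 2
      cancel₂ = solve-∀

    -- the term β = ν + 2 produced by the recurrence at b = 0 is the other parity class at b = 0
    B-bottom : ∀ {n c} → Admissible (suc n) c 0 → ∀ m →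
               Bν (suc n) c 0 m ≡ Bν n (not c) 0 m + Bν n c 1 m - Δ n (Bν (n ℕ.∸ 1) c 0) m
    B-bottom {n} {c} adm m = begin
      Bc (σ c) (β 0) (suc n) m
        ≡⟨ B-recurrence (σ c) (β 0) n m ⟩
      Bc (σ c) (β 0 + + 1) n m + Bc (σ c) (β 0 - + 1) n m - Δ n (Bc (σ c) (β 0) (n ℕ.∸ 1)) m
        ≡⟨ cong₂ (λ x y → x + y - Δ n (Bc (σ c) (β 0) (n ℕ.∸ 1)) m) reflected
                 (cong (λ b′ → Bc (σ c) b′ n m) (β-pred 0)) ⟩
      Bc (σ (not c)) (β 0) n m + Bc (σ c) (β 1) n m - Δ n (Bc (σ c) (β 0) (n ℕ.∸ 1)) m ∎
      where
      numerator : + n + + (ν ℕ.+ 2) - σ c ≡ + suc n + β 0 - σ c + + 2 * + 0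
      numerator = trans (cong (λ p → + n + p - σ c) (ℤP.pos-+ ν 2))
        (trans (rearrange (+ n) (+ ν) (σ c))
               (cong₂ (λ x p → x + (p - + 0) - σ c + + 2 * + 0) (sym (ℤP.pos-+ 1 n)) (sym ν+1≡)))
        where
        rearrange : ∀ n v σ → n + (v + + 2) - σ ≡ + 1 + n + (v + + 1 - + 0) - σ + + 2 * + 0
        rearrange = solve-∀
      reflected : Bc (σ c) (β 0 + + 1) n m ≡ Bc (σ (not c)) (β 0) n m
      reflected = begin
        Bc (σ c) (β 0 + + 1) n m
          ≡⟨ cong (λ b′ → Bc (σ c) b′ n m) (trans (cong (_+ + 1) (ℤP.+-identityʳ (+ (ν ℕ.+ 1))))
                                                   (cong +_ (ℕP.+-assoc ν 1 1))) ⟩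
        Bc (σ c) (+ (ν ℕ.+ 2)) n m
          ≡⟨ B-reflection (σ c) n m (even-shift (+ 0) (even-numerator {suc n} {c} {0} adm) numerator) ⟩
        Bc (K - σ c) (+ (ν ℕ.+ 1)) n m
          ≡⟨ cong₂ (λ σ′ b′ → Bc σ′ b′ n m) (K-σ c) (sym (ℤP.+-identityʳ (+ (ν ℕ.+ 1)))) ⟩
        Bc (σ (not c)) (β 0) n m ∎

    B-middle : ∀ {n c b} → suc (suc b) ℕ.≤ ν → Admissible (suc n) c (suc b) → ∀ m →
               Bν (suc n) c (suc b) m ≡ Bν n c b m + Bν n c (suc (suc b)) m - Δ n (Bν (n ℕ.∸ 1) c (suc b)) m
    B-middle {n} {c} {b} _ _ m = trans (B-recurrence (σ c) (β (suc b)) n m)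
      (cong₂ (λ x y → Bc (σ c) x n m + Bc (σ c) y n m - Δ n (Bc (σ c) (β (suc b)) (n ℕ.∸ 1)) m)
             (β-suc b) (β-pred (suc b)))

    -- at b = ν (β = 1) the recurrence produces β = 0, whose contribution B-edge cancels
    B-top : ∀ {n c b} → suc b ≡ ν → Admissible (suc n) c (suc b) → ∀ m → Bν (suc n) c (suc b) m ≡ Bν n c b m
    B-top {n} {c} {b} b+1≡ν adm m = begin
      Bc (σ c) (β (suc b)) (suc n) m
        ≡⟨ cong (λ b′ → Bc (σ c) b′ (suc n) m) β₁ ⟩
      Bc (σ c) (+ 1) (suc n) m
        ≡⟨ B-recurrence (σ c) (+ 1) n m ⟩
      Bc (σ c) (+ 2) n m + Bc (σ c) (+ 0) n m - Δ n (Bc (σ c) (+ 1) (n ℕ.∸ 1)) m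
        ≡⟨ ℤP.+-assoc (Bc (σ c) (+ 2) n m) _ _ ⟩
      Bc (σ c) (+ 2) n m + (Bc (σ c) (+ 0) n m - Δ n (Bc (σ c) (+ 1) (n ℕ.∸ 1)) m)
        ≡⟨ cong (λ x → Bc (σ c) (+ 2) n m + x)
                (B-edge (σ c) n m (even-shift (- + 1) (even-numerator {suc n} {c} {suc b} adm) numerator)) ⟩
      Bc (σ c) (+ 2) n m + + 0
        ≡⟨ trans (ℤP.+-identityʳ _) (cong (λ b′ → Bc (σ c) b′ n m) (sym β₂)) ⟩
      Bc (σ c) (β b) n m ∎
      where
      β₁ : β (suc b) ≡ + 1
      β₁ = proj₁ (β-top b+1≡ν)
      β₂ : β b ≡ + 2
      β₂ = proj₂ (β-top b+1≡ν)
      numerator : + n - σ c ≡ + suc n + β (suc b) - σ c + + 2 * - + 1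
      numerator = trans (rearrange (+ n) (σ c))
        (cong₂ (λ x y → x + y - σ c + + 2 * - + 1) (sym (ℤP.pos-+ 1 n)) (sym β₁))
        where
        rearrange : ∀ n σ → n - σ ≡ + 1 + n + + 1 - σ + + 2 * - + 1
        rearrange = solve-∀

    B-recurrent : Recurrent Bν
    B-recurrent = record { bottom = B-bottom ; middle = B-middle ; top = B-top }

    C-recurrent : 1 ℕ.≤ ν → s ℕ.≤ ν → Recurrent Cν
    C-recurrent 1≤ν s≤ν = record
      { bottom = λ {n} _ m → C-bottom 1≤ν n m
      ; middle = λ {n} {_} {b} b+2≤ν _ m → C-middle n b m b+2≤ν
      ; top    = λ {n} {_} {b} b+1≡ν _ m → C-top s≤ν n b m b+1≡ν
      }

    private
      β≡ : ∀ {b} → b ℕ.≤ ν → β b ≡ + suc (ν ℕ.∸ b)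
      β≡ {b} b≤ν = trans (ℤP.m-n≡m⊖n (ν ℕ.+ 1) b)
        (trans (ℤP.⊖-≥ (ℕP.≤-trans b≤ν (ℕP.m≤m+n ν 1)))
               (cong +_ (trans (ℕP.+-∸-comm 1 b≤ν) (ℕP.+-comm _ 1))))

      σℕ : Bool → ℕ
      σℕ false = suc (ν ℕ.∸ s)
      σℕ true  = ν ℕ.+ 2 ℕ.+ s

      σ≡ : s ℕ.≤ ν → ∀ c → σ c ≡ + σℕ c
      σ≡ s≤ν false = β≡ s≤ν
      σ≡ s≤ν true  = refl

      σℕ≤ : s ℕ.≤ ν → ∀ c → σℕ c ℕ.≤ ν ℕ.+ 2 ℕ.+ ν
      σℕ≤ s≤ν false = ℕP.≤-trans (s≤s (ℕP.m∸n≤m ν s))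
        (ℕP.≤-trans (ℕP.≤-reflexive (ℕP.+-comm 1 ν))
                    (ℕP.≤-trans (ℕP.+-monoʳ-≤ ν (s≤s z≤n)) (ℕP.m≤m+n (ν ℕ.+ 2) ν)))
      σℕ≤ s≤ν true  = ℕP.+-monoʳ-≤ (ν ℕ.+ 2) s≤ν

      β≢σ : s ℕ.≤ ν → ∀ {b} → b ℕ.≤ ν → ∀ c → s ≢ b → β b ≢ σ c
      β≢σ s≤ν b≤ν false s≢b β≡σ = s≢b (sym (ℕP.∸-cancelˡ-≡ b≤ν s≤ν
        (ℕP.suc-injective (ℤP.+-injective (trans (sym (β≡ b≤ν)) (trans β≡σ (β≡ s≤ν)))))))
      β≢σ s≤ν {b} b≤ν true _ β≡σ = ℕP.<-irrefl refl (ℕP.≤-trans (ℕP.≤-reflexive (ℕP.+-comm 2 ν))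
        (ℕP.≤-trans (ℕP.m≤m+n (ν ℕ.+ 2) s)
          (ℕP.≤-trans (ℕP.≤-reflexive (sym (ℤP.+-injective (trans (sym (β≡ b≤ν)) β≡σ))))
                      (s≤s (ℕP.m∸n≤m ν b)))))

      initial-value : s ℕ.≤ ν → ∀ c b → b ℕ.≤ ν → Admissible 0 c b → Even (β b - σ c) → ∀ m →
                      gauss 0 (half (β b - σ c)) m ≡ when (s ℕ.≡ᵇ b) (coeff oneP m)
      initial-value s≤ν c b b≤ν adm ev m with s ℕ.≟ b
      initial-value s≤ν false b b≤ν adm ev m | yes refl =
        trans (cong (λ x → gauss 0 (half x) m) (ℤP.+-inverseʳ (β s))) (sym (when-true _ (ℕP.≡⇒≡ᵇ s s refl)))
      initial-value s≤ν true b b≤ν (a , odd) ev m | yes refl =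
        ⊥-elim (even≢odd a (- + s - + 1) (trans (sym odd) (rearrange (+ s))))
        where
        rearrange : ∀ s → + 0 - s - s - + 1 ≡ + 2 * (- s - + 1) + + 1
        rearrange = solve-∀
      initial-value s≤ν c b b≤ν adm (w , even) m | no s≢b =
        trans (gauss-0-nonzero m half≢0) (sym (when-false _ (s≢b ∘ ℕP.≡ᵇ⇒≡ s b)))
        where
        half≢0 : half (β b - σ c) ≢ + 0
        half≢0 h≡0 = β≢σ s≤ν b≤ν c s≢b (ℤP.i-j≡0⇒i≡j (β b) (σ c)
          (trans even (cong (+ 2 *_) (trans (sym (half-even even)) h≡0))))

    B-initial-value : s ℕ.≤ ν → ∀ c b → b ℕ.≤ ν → Admissible 0 c b → ∀ m →
                      Bν 0 c b m ≡ when (s ℕ.≡ᵇ b) (coeff oneP m)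
    B-initial-value s≤ν c b b≤ν adm m =
      trans (B-initial (σ c) (β b) m even bound nonzero) (initial-value s≤ν c b b≤ν adm even m)
      where
      even : Even (β b - σ c)
      even = subst Even (cong (_- σ c) (ℤP.+-identityˡ (β b))) (even-numerator {0} {c} {b} adm)
      bound : ∣ β b ∣ ℕ.+ ∣ σ c ∣ ℕ.< 2 ℕ.* K′
      bound = subst₂ (λ x y → ∣ x ∣ ℕ.+ ∣ y ∣ ℕ.< 2 ℕ.* K′) (sym (β≡ b≤ν)) (sym (σ≡ s≤ν c))
        (ℕP.≤-trans (s≤s (ℕP.+-mono-≤ (s≤s (ℕP.m∸n≤m ν b)) (σℕ≤ s≤ν c)))
                    (ℕP.≤-trans (ℕP.m≤m+n _ (ν ℕ.+ 2)) (ℕP.≤-reflexive (sym (expand ν)))))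
        where
        expand : ∀ ν → 2 ℕ.* (2 ℕ.* ν ℕ.+ 3) ≡ suc (suc ν ℕ.+ (ν ℕ.+ 2 ℕ.+ ν)) ℕ.+ (ν ℕ.+ 2)
        expand = ℕRing.solve-∀
      nonzero : β b + σ c ≢ + 0
      nonzero = subst₂ (λ x y → x + y ≢ + 0) (sym (β≡ b≤ν)) (sym (σ≡ s≤ν c)) (λ ())

    B≡C : 1 ℕ.≤ ν → s ℕ.≤ ν → ∀ n c b → b ℕ.≤ ν → Admissible n c b → Bν n c b ≗ Cν n c b
    B≡C 1≤ν s≤ν = recurrent-unique 1≤ν B-recurrent (C-recurrent 1≤ν s≤ν)
      (λ c b b≤ν adm m → trans (B-initial-value s≤ν c b b≤ν adm m) (sym (C-initial b m)))

    admissible-same : ∀ L b → L % 2 ≡ (s ℕ.+ b) % 2 → Admissible L false b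
    admissible-same L b same = even-shift (+ 0) (same-parity⇒even L (s ℕ.+ b) same)
      (trans (rearrange (+ L) (+ s) (+ b)) (cong (λ x → + L - x + + 2 * + 0) (sym (ℤP.pos-+ s b))))
      where
      rearrange : ∀ l s b → l - s - b - + 0 ≡ l - (s + b) + + 2 * + 0
      rearrange = solve-∀

    admissible-different : ∀ L b → L % 2 ≢ (s ℕ.+ b) % 2 → Admissible L true b
    admissible-different L b different = even-shift (+ 0) (different-parity⇒odd L (s ℕ.+ b) different)
      (trans (rearrange (+ L) (+ s) (+ b)) (cong (λ x → + L - x - + 1 + + 2 * + 0) (sym (ℤP.pos-+ s b))))
      where
      rearrange : ∀ l s b → l - s - b - + 1 ≡ l - (s + b) - + 1 + + 2 * + 0
      rearrange = solve-∀

open import Data.Nat using (ℕ; _≤_; _%_; _+_)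
open import Data.Integer using (+_; _-_)
open import Data.Bool using (true; false)
open import Data.Product using (_×_; _,_)
open import Relation.Binary.PropositionalEquality using (_≡_; sym)
open import Relation.Nullary using (¬_)

mainTheorem1 : (ν s b L : ℕ) → 1 ≤ ν → s ≤ ν → b ≤ ν →
    ((L % 2 ≡ (s + b) % 2) → Cfun ν (+ 0) L s b ≈ Bfun ν (+ (ν + 1) - + s) (+ (ν + 1) - + b) L)
    × (¬ (L % 2 ≡ (s + b) % 2) → Cfun ν (+ 0) L s b ≈ Bfun ν (+ (ν + 2 + s)) (+ (ν + 1) - + b) L)
mainTheorem1 ν s b L 1≤ν s≤ν b≤ν =
    (λ same n → sym (B≡C 1≤ν s≤ν L false b b≤ν (admissible-same L b same) n))
  , (λ different n → sym (B≡C 1≤ν s≤ν L true b b≤ν (admissible-different L b different) n))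
  where
  open Recurrence ν s
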